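{- For $n\geqslant 1$, define $$B_n(x,y,s,t,p,q)=\sum_{\sigma\in\mathcal{S}^B_n}x^{\mathrm{exc}(\sigma)}y^{\mathrm{aexc}(\sigma)}s^{\mathrm{single}(\sigma)}t^{\mathrm{fix}(\sigma)}p^{\mathrm{neg}(\sigma)}q^{\mathrm{cyc}(\sigma)}$$ and $A_n(x,p,q)=\sum_{\pi\in\mathcal{S}_n}x^{\mathrm{exc}(\pi)}p^{\mathrm{fix}(\pi)}q^{\mathrm{cyc}(\pi)}$. Then $$B_n(x,y,s,t,p,q)=(1+p)^ny^nA_n\left(\frac{x}{y},\frac{t+sp}{(1+p)y},q\right).$$
   Context: $\mathcal{S}^B_n$ is the hyperoctahedral group: bijections $\sigma$ of $\pm[n]=\{\pm1,\dots,\pm n\}$ with $\sigma(-i)=-\sigma(i)$, written $\sigma=\sigma(1)\cdots\sigma(n)$. For $\sigma\in\mathcal{S}^B_n$ and $i\in[n]$: $i$ is an excedance if $\sigma(|\sigma(i)|)>\sigma(i)$, an anti-excedance if $\sigma(|\sigma(i)|)<\sigma(i)$, a fixed point if $\sigma(i)=i$, a singleton if $\sigma(i)=-i$; $\mathrm{exc},\mathrm{aexc},\mathrm{fix},\mathrm{single}$ count these, $\mathrm{neg}(\sigma)=\#\{i\in[n]:\sigma(i)<0\}$, and $\mathrm{cyc}(\sigma)$ is the number of cycles of the permutation $i\mapsto|\sigma(i)|$ of $[n]$. For $\pi\in\mathcal{S}_n$: $\mathrm{exc}(\pi)=\#\{i:\pi(i)>i\}$, $\mathrm{fix}(\pi)=\#\{i:\pi(i)=i\}$,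 $\mathrm{cyc}(\pi)$ the number of cycles. The right-hand side is a polynomial since each monomial of $A_n$ has total $x$- and $p$-degree at most $n$. -}

module Defs where

open import Level using (Level)
open import Data.Bool using (Bool; true; false; if_then_else_; _∧_)
open import Data.Nat using (ℕ; zero; suc; _∸_; _≤ᵇ_; _<ᵇ_)
open import Data.Fin using (Fin; toℕ; _≟_)
open import Data.Fin.Properties using () renaming (_≟_ to _≟ᶠ_)
open import Data.Integer using (ℤ; +_; -[1+_]) renaming (_<?_ to _<ℤ?_)
open import Data.List using (List; []; _∷_; map; concatMap; filter; allFin; foldr; upTo)
open import Data.Nat.ListAction using (sum)
open import Data.List using (and)

all : ∀ {a} {A : Set a} → (A → Bool) → List A → Bool
all p xs = and (map p xs)
import Data.Vec
open import Data.Vec using (Vec; []; _∷_; lookup; toList)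
open import Data.Product using (_×_; _,_; proj₁; proj₂)
open import Relation.Nullary.Decidable using (⌊_⌋; does)
open import Algebra.Bundles using (CommutativeRing)

allVecs : ∀ {a} {A : Set a} → List A → (n : ℕ) → List (Vec A n)
allVecs xs zero    = [] ∷ []
allVecs xs (suc n) = concatMap (λ x → map (x ∷_) (allVecs xs n)) xs

count : (n : ℕ) → (Fin n → Bool) → ℕ
count n P = sum (map (λ i → if P i then 1 else 0) (allFin n))

-- is the map i ↦ lookup v i injective (hence bijective) on Fin n
isPerm : ∀ {n} → Vec (Fin n) n → Bool
isPerm {n} v = all (λ i → all (λ j → if does (lookup v i ≟ lookup v j) then does (i ≟ j) else true) (allFin n)) (allFin n)

-- The symmetric group S_n: π ∈ S_n is stored as the vector (π(1),…,π(n)),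
-- with [n] represented by Fin n (i ↔ toℕ i + 1).

Perm : ℕ → Set
Perm n = Vec (Fin n) n

Sn : (n : ℕ) → List (Perm n)
Sn n = filter (λ v → isPerm v ≟ᵇ true) (allVecs (allFin n) n)
  where
  open import Data.Bool.Properties using () renaming (_≟_ to _≟ᵇ_)

iter : ∀ {n} → Perm n → ℕ → Fin n → Fin n
iter π zero    i = i
iter π (suc k) i = lookup π (iter π k i)

isCycleMin : ∀ {n} → Perm n → Fin n → Bool
isCycleMin {n} π i = all (λ k → toℕ i ≤ᵇ toℕ (iter π k i)) (upTo n)

excA fixA cycA : ∀ {n} → Perm n → ℕ
excA {n} π = count n (λ i → toℕ i <ᵇ toℕ (lookup π i))
fixA {n} π = count n (λ i → does (lookup π i ≟ i))
-- number of cycles = number of cycle minima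
cycA {n} π = count n (isCycleMin π)

-- The hyperoctahedral group S^B_n: σ is stored as the vector of pairs
-- (b, j) with σ(i) = -(toℕ j + 1) if b = true and σ(i) = toℕ j + 1 if b = false.
-- σ(-i) = -σ(i) determines the rest.

SPerm : ℕ → Set
SPerm n = Vec (Bool × Fin n) n

absPerm : ∀ {n} → SPerm n → Perm n
absPerm σ = Data.Vec.map proj₂ σ

SBn : (n : ℕ) → List (SPerm n)
SBn n = filter (λ σ → isPerm (absPerm σ) ≟ᵇ true) (allVecs allSigned n)
  where
  open import Data.Bool.Properties using () renaming (_≟_ to _≟ᵇ_)
  allSigned : List (Bool × Fin n)
  allSigned = concatMap (λ b → map (b ,_) (allFin n)) (true ∷ false ∷ [])

sval : ∀ {n} → Bool × Fin n → ℤ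
sval (true  , j) = -[1+ toℕ j ]
sval (false , j) = + suc (toℕ j)

σat : ∀ {n} → SPerm n → Fin n → ℤ
σat σ i = sval (lookup σ i)

σat² : ∀ {n} → SPerm n → Fin n → ℤ
σat² σ i = sval (lookup σ (proj₂ (lookup σ i)))

excB aexcB fixB singleB negB cycB : ∀ {n} → SPerm n → ℕ
excB    {n} σ = count n (λ i → does (σat σ i <ℤ? σat² σ i))
aexcB   {n} σ = count n (λ i → does (σat² σ i <ℤ? σat σ i))
fixB    {n} σ = count n (λ i → (not (proj₁ (lookup σ i))) ∧ does (proj₂ (lookup σ i) ≟ i))
  where open import Data.Bool using (not)
singleB {n} σ = count n (λ i → proj₁ (lookup σ i) ∧ does (proj₂ (lookup σ i) ≟ i))
negB    {n} σ = count n (λ i → proj₁ (lookup σ i))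
cycB        σ = cycA (absPerm σ)

module Eval {c ℓ : Level} (R : CommutativeRing c ℓ) where
  open CommutativeRing R

  infixr 8 _^_
  _^_ : Carrier → ℕ → Carrier
  a ^ zero  = 1#
  a ^ suc k = a * (a ^ k)

  Σ : ∀ {a} {A : Set a} → List A → (A → Carrier) → Carrier
  Σ xs f = foldr (λ z acc → f z + acc) 0# xs

  B : (n : ℕ) → (x y s t p q : Carrier) → Carrier
  B n x y s t p q = Σ (SBn n) (λ σ →
    (x ^ excB σ) * (y ^ aexcB σ) * (s ^ singleB σ) * (t ^ fixB σ) * (p ^ negB σ) * (q ^ cycB σ))

  A : (n : ℕ) → (x p q : Carrier) → Carrier
  A n x p q = Σ (Sn n) (λ π → (x ^ excA π) * (p ^ fixA π) * (q ^ cycA π))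

  -- (1+p)^n y^n A_n(x/y, (t+sp)/((1+p)y), q), with the powers of y and (1+p)
  -- distributed into each monomial (exc π + fix π ≤ n), so it is a polynomial:
  -- Σ_π x^exc y^(n-exc-fix) (t+sp)^fix (1+p)^(n-fix) q^cyc
  RHS : (n : ℕ) → (x y s t p q : Carrier) → Carrier
  RHS n x y s t p q = Σ (Sn n) (λ π →
    (x ^ excA π) * (y ^ (n ∸ excA π ∸ fixA π)) * ((t + s * p) ^ fixA π)
      * ((1# + p) ^ (n ∸ fixA π)) * (q ^ cycA π))

-- For σ ∈ S^B_n write π = ∣σ∣.  Over S^B_n the tuple (exc, aexc, single, fix, neg, cyc) of σ has the
-- same joint distribution as the tuple in which exc, aexc and cyc are replaced by the excedances,
-- anti-excedances and cycles of π.  Both tuples obey the same recursion: every element of S^B_{n+1}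
-- arises exactly once from some σ ∈ S^B_n by inserting ±(n+1) either as a new cycle or right after
-- ∣σ(k)∣, and the new tuple is determined by the old one, the sign of n+1 and whether k is an
-- excedance, anti-excedance, fixed point or singleton (for the unsigned tuple: whether π(k) is an
-- excedance or anti-excedance of π), each class having as many members as the corresponding
-- statistic counts.  For the unsigned tuple the sum over the signs factors for each π: every fixed
-- point contributes t + sp and every other point 1 + p, and aexc π = n − exc π − fix π.
module Submission where

open import Defs
open import Level using (Level)
open import Data.Nat using (ℕ; _≤_)
open import Algebra.Bundles using (CommutativeRing)

module Counting where

  open import Data.Bool using (Bool; true; false; if_then_else_; not)
  open import Data.Nat using (ℕ; zero; suc; _+_; _≤_)
  open import Data.Nat.Properties using (+-comm; +-assoc; m≤m+n; 1+n≰n; +-commutativeSemigroup)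
  open import Algebra.Properties.CommutativeSemigroup +-commutativeSemigroup using (interchange; xy∙z≈xz∙y)
  open import Data.Fin using (Fin; inject₁; fromℕ)
  import Data.Fin as Fin
  open import Data.Fin.Properties using (suc-injective; any?; punchOut-injective; injective⇒≤)
  open import Data.List using (List; map; allFin)
  open import Data.List.Properties using (map-tabulate; map-∘)
  open import Data.List.Membership.Propositional using (_∈_)
  open import Data.List.Membership.Propositional.Properties using (∈-allFin; ∈-map⁺)
  import Data.List.Relation.Binary.Permutation.Propositional.Properties as ↭
  open import Data.List.Relation.Unary.Unique.Propositional using (Unique)
  import Data.List.Relation.Unary.Unique.Propositional.Properties as Unique
  open import Data.List.Relation.Binary.BagAndSetEquality using (∼bag⇒↭)
  open import Data.List.Relation.Binary.Permutation.Propositional using (_↭_)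
  open import Data.List.Membership.Propositional.Properties.WithK using (unique∧set⇒bag)
  open import Data.Nat.ListAction using (sum)
  open import Data.Nat.ListAction.Properties using (sum-↭)
  open import Data.Product using (∃; _,_)
  open import Data.Empty using (⊥-elim)
  open import Function using (_∘_)
  open import Function.Bundles using (mk⇔)
  open import Function.Definitions using (Injective)
  open import Relation.Binary.PropositionalEquality
  open import Relation.Nullary using (yes; no; does)
  open import Relation.Nullary.Decidable using (dec-true; dec-false)

  𝟙 : Bool → ℕ
  𝟙 b = if b then 1 else 0

  𝟙-not : ∀ b → 𝟙 b + 𝟙 (not b) ≡ 1
  𝟙-not true  = refl
  𝟙-not false = refl

  open ≡-Reasoning

  count-suc : ∀ n (P : Fin (suc n) → Bool) →
              count (suc n) P ≡ 𝟙 (P Fin.zero) + count n (P ∘ Fin.suc)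
  count-suc n P = cong (λ l → 𝟙 (P Fin.zero) + sum l)
    (trans (map-tabulate Fin.suc (𝟙 ∘ P)) (sym (map-tabulate (λ i → i) (𝟙 ∘ P ∘ Fin.suc))))

  count-cong : ∀ n {P Q : Fin n → Bool} → (∀ i → P i ≡ Q i) → count n P ≡ count n Q
  count-cong zero    eq = refl
  count-cong (suc n) {P} {Q} eq = begin
    count (suc n) P                       ≡⟨ count-suc n P ⟩
    𝟙 (P Fin.zero) + count n (P ∘ Fin.suc) ≡⟨ cong₂ _+_ (cong 𝟙 (eq Fin.zero)) (count-cong n (eq ∘ Fin.suc)) ⟩
    𝟙 (Q Fin.zero) + count n (Q ∘ Fin.suc) ≡⟨ count-suc n Q ⟨
    count (suc n) Q                       ∎

  count-last : ∀ n (P : Fin (suc n) → Bool) →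
               count (suc n) P ≡ count n (P ∘ inject₁) + 𝟙 (P (fromℕ n))
  count-last zero    P = trans (count-suc zero P) (+-comm (𝟙 (P Fin.zero)) 0)
  count-last (suc n) P = begin
    count (suc (suc n)) P
      ≡⟨ count-suc (suc n) P ⟩
    𝟙 (P Fin.zero) + count (suc n) (P ∘ Fin.suc)
      ≡⟨ cong (𝟙 (P Fin.zero) +_) (count-last n (P ∘ Fin.suc)) ⟩
    𝟙 (P Fin.zero) + (count n (P ∘ Fin.suc ∘ inject₁) + 𝟙 (P (fromℕ (suc n))))
      ≡⟨ +-assoc (𝟙 (P Fin.zero)) _ _ ⟨
    𝟙 (P Fin.zero) + count n (P ∘ Fin.suc ∘ inject₁) + 𝟙 (P (fromℕ (suc n)))
      ≡⟨ cong (_+ 𝟙 (P (fromℕ (suc n)))) (count-suc n (P ∘ inject₁)) ⟨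
    count (suc n) (P ∘ inject₁) + 𝟙 (P (fromℕ (suc n)))
      ∎

  count-agree-except : ∀ n (j : Fin n) {P Q : Fin n → Bool} → (∀ m → m ≢ j → P m ≡ Q m) →
                       count n P + 𝟙 (Q j) ≡ count n Q + 𝟙 (P j)
  count-agree-except (suc n) Fin.zero {P} {Q} eq = begin
    count (suc n) P + 𝟙 (Q Fin.zero)
      ≡⟨ cong (_+ 𝟙 (Q Fin.zero)) (count-suc n P) ⟩
    𝟙 (P Fin.zero) + count n (P ∘ Fin.suc) + 𝟙 (Q Fin.zero)
      ≡⟨ cong (λ c → 𝟙 (P Fin.zero) + c + 𝟙 (Q Fin.zero)) (count-cong n (λ i → eq (Fin.suc i) λ ())) ⟩
    𝟙 (P Fin.zero) + count n (Q ∘ Fin.suc) + 𝟙 (Q Fin.zero)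
      ≡⟨ +-assoc (𝟙 (P Fin.zero)) _ _ ⟩
    𝟙 (P Fin.zero) + (count n (Q ∘ Fin.suc) + 𝟙 (Q Fin.zero))
      ≡⟨ cong (𝟙 (P Fin.zero) +_) (trans (+-comm (count n (Q ∘ Fin.suc)) _) (sym (count-suc n Q))) ⟩
    𝟙 (P Fin.zero) + count (suc n) Q
      ≡⟨ +-comm (𝟙 (P Fin.zero)) _ ⟩
    count (suc n) Q + 𝟙 (P Fin.zero)
      ∎
  count-agree-except (suc n) (Fin.suc j) {P} {Q} eq = begin
    count (suc n) P + 𝟙 (Q (Fin.suc j))
      ≡⟨ cong (_+ 𝟙 (Q (Fin.suc j))) (count-suc n P) ⟩
    𝟙 (P Fin.zero) + count n (P ∘ Fin.suc) + 𝟙 (Q (Fin.suc j))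
      ≡⟨ +-assoc (𝟙 (P Fin.zero)) _ _ ⟩
    𝟙 (P Fin.zero) + (count n (P ∘ Fin.suc) + 𝟙 (Q (Fin.suc j)))
      ≡⟨ cong₂ _+_ (cong 𝟙 (eq Fin.zero λ ()))
                   (count-agree-except n j (λ m m≢j → eq (Fin.suc m) (m≢j ∘ suc-injective))) ⟩
    𝟙 (Q Fin.zero) + (count n (Q ∘ Fin.suc) + 𝟙 (P (Fin.suc j)))
      ≡⟨ +-assoc (𝟙 (Q Fin.zero)) _ _ ⟨
    𝟙 (Q Fin.zero) + count n (Q ∘ Fin.suc) + 𝟙 (P (Fin.suc j))
      ≡⟨ cong (_+ 𝟙 (P (Fin.suc j))) (count-suc n Q) ⟨
    count (suc n) Q + 𝟙 (P (Fin.suc j))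
      ∎

  count-agree-except₂ : ∀ n {a b : Fin n} {P Q : Fin n → Bool} → a ≢ b →
                        (∀ m → m ≢ a → m ≢ b → P m ≡ Q m) →
                        count n P + 𝟙 (Q a) + 𝟙 (Q b) ≡ count n Q + 𝟙 (P a) + 𝟙 (P b)
  count-agree-except₂ n {a} {b} {P} {Q} a≢b agree = begin
    count n P + 𝟙 (Q a) + 𝟙 (Q b) ≡⟨ cong (λ z → count n P + 𝟙 z + 𝟙 (Q b)) Ma≡Qa ⟨
    count n P + 𝟙 (M a) + 𝟙 (Q b) ≡⟨ cong (_+ 𝟙 (Q b)) (count-agree-except n a {P} {M} P≈M) ⟩
    count n M + 𝟙 (P a) + 𝟙 (Q b) ≡⟨ xy∙z≈xz∙y (count n M) _ _ ⟩
    count n M + 𝟙 (Q b) + 𝟙 (P a) ≡⟨ cong (_+ 𝟙 (P a)) (count-agree-except n b {M} {Q} M≈Q) ⟩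
    count n Q + 𝟙 (M b) + 𝟙 (P a) ≡⟨ cong (λ z → count n Q + 𝟙 z + 𝟙 (P a)) Mb≡Pb ⟩
    count n Q + 𝟙 (P b) + 𝟙 (P a) ≡⟨ xy∙z≈xz∙y (count n Q) _ _ ⟩
    count n Q + 𝟙 (P a) + 𝟙 (P b) ∎
    where
    M : Fin n → Bool
    M m = if does (m Fin.≟ a) then Q m else P m
    P≈M : ∀ m → m ≢ a → P m ≡ M m
    P≈M m m≢a rewrite dec-false (m Fin.≟ a) m≢a = refl
    M≈Q : ∀ m → m ≢ b → M m ≡ Q m
    M≈Q m m≢b with m Fin.≟ a
    ... | yes _   = refl
    ... | no m≢a  = agree m m≢a m≢b
    Mb≡Pb : M b ≡ P b
    Mb≡Pb rewrite dec-false (b Fin.≟ a) (a≢b ∘ sym) = refl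
    Ma≡Qa : M a ≡ Q a
    Ma≡Qa rewrite dec-true (a Fin.≟ a) refl = refl

  count-split : ∀ n {P Q S : Fin n → Bool} → (∀ i → 𝟙 (P i) ≡ 𝟙 (Q i) + 𝟙 (S i)) →
                count n P ≡ count n Q + count n S
  count-split zero    eq = refl
  count-split (suc n) {P} {Q} {S} eq = begin
    count (suc n) P
      ≡⟨ count-suc n P ⟩
    𝟙 (P Fin.zero) + count n (P ∘ Fin.suc)
      ≡⟨ cong₂ _+_ (eq Fin.zero) (count-split n (eq ∘ Fin.suc)) ⟩
    𝟙 (Q Fin.zero) + 𝟙 (S Fin.zero) + (count n (Q ∘ Fin.suc) + count n (S ∘ Fin.suc))
      ≡⟨ interchange (𝟙 (Q Fin.zero)) (𝟙 (S Fin.zero)) _ _ ⟩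
    𝟙 (Q Fin.zero) + count n (Q ∘ Fin.suc) + (𝟙 (S Fin.zero) + count n (S ∘ Fin.suc))
      ≡⟨ cong₂ _+_ (count-suc n Q) (count-suc n S) ⟨
    count (suc n) Q + count (suc n) S
      ∎

  count-true : ∀ n → count n (λ _ → true) ≡ n
  count-true zero    = refl
  count-true (suc n) = trans (count-suc n (λ _ → true)) (cong suc (count-true n))

  count-complement : ∀ n (P : Fin n → Bool) → count n P + count n (not ∘ P) ≡ n
  count-complement n P =
    trans (sym (count-split n {P = λ _ → true} (λ i → sym (𝟙-not (P i))))) (count-true n)

  count≤ : ∀ n (P : Fin n → Bool) → count n P ≤ n
  count≤ n P = subst (count n P ≤_) (count-complement n P) (m≤m+n _ _)

  injective⇒surjective : ∀ {n} {f : Fin n → Fin n} → Injective _≡_ _≡_ f → ∀ j → ∃ λ i → f i ≡ j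
  injective⇒surjective {suc n} {f} inj j with any? (λ i → f i Fin.≟ j)
  ... | yes hit = hit
  ... | no miss = ⊥-elim (1+n≰n (injective⇒≤ {f = skip} skip-injective))
    where
    skip : Fin (suc n) → Fin n
    skip i = Fin.punchOut {i = j} (λ e → miss (i , sym e))
    skip-injective : ∀ {x y} → skip x ≡ skip y → x ≡ y
    skip-injective e = inj (punchOut-injective {i = j} _ _ e)

  unique-↭ : ∀ {a} {A : Set a} {xs ys : List A} → Unique xs → Unique ys →
             (∀ {x} → x ∈ xs → x ∈ ys) → (∀ {x} → x ∈ ys → x ∈ xs) → xs ↭ ys
  unique-↭ u v f g = ∼bag⇒↭ (unique∧set⇒bag u v (mk⇔ f g))

  count-reindex : ∀ n {f : Fin n → Fin n} → Injective _≡_ _≡_ f →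
                  (P : Fin n → Bool) → count n (P ∘ f) ≡ count n P
  count-reindex n {f} inj P = begin
    sum (map (𝟙 ∘ P ∘ f) (allFin n))       ≡⟨ cong sum (map-∘ (allFin n)) ⟩
    sum (map (𝟙 ∘ P) (map f (allFin n)))   ≡⟨ sum-↭ (↭.map⁺ (𝟙 ∘ P) f-allFin-↭) ⟩
    sum (map (𝟙 ∘ P) (allFin n))           ∎
    where
    f-allFin-↭ : map f (allFin n) ↭ allFin n
    f-allFin-↭ = unique-↭ (Unique.map⁺ inj (Unique.allFin⁺ n)) (Unique.allFin⁺ n)
      (λ _ → ∈-allFin _)
      (λ {j} _ → let (i , fi≡j) = injective⇒surjective inj j
                 in subst (_∈ map f (allFin n)) fi≡j (∈-map⁺ f (∈-allFin i)))

open Counting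

module Enumeration where

  open import Data.Bool using (Bool; true; false; if_then_else_; T)
  open import Data.Bool.Properties using (T-≡) renaming (_≟_ to _≟ᵇ_)
  open import Data.Nat using (ℕ; zero; suc)
  open import Data.Fin using (Fin; _≟_)
  import Data.Fin as Fin
  open import Data.List using (List; []; _∷_; map; concatMap; allFin)
  open import Data.List.Membership.Propositional using (_∈_; find)
  open import Data.List.Membership.Propositional.Properties
    using (∈-allFin; ∈-map⁺; ∈-map⁻; ∈-concatMap⁺; ∈-concatMap⁻; ∈-filter⁺; ∈-filter⁻)
  open import Data.List.Relation.Unary.Any using (here; there)
  import Data.List.Relation.Unary.Any as Any
  open import Data.List.Relation.Unary.All using ([]; _∷_)
  import Data.List.Relation.Unary.All as All
  import Data.List.Relation.Unary.All.Properties as All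
  open import Data.List.Relation.Unary.AllPairs using ([]; _∷_)
  open import Data.List.Relation.Unary.Unique.Propositional using (Unique)
  import Data.List.Relation.Unary.Unique.Propositional.Properties as Unique
  open import Data.List.Relation.Binary.Disjoint.Propositional using (Disjoint)
  open import Data.Vec using (Vec; []; _∷_; lookup)
  open import Data.Vec.Properties using (∷-injectiveˡ; ∷-injectiveʳ; lookup-map)
  open import Data.Product using (_×_; _,_; proj₁; proj₂)
  open import Function using (_∘_; _⇔_; Equivalence; mk⇔)
  open import Function.Definitions using (Injective)
  open import Relation.Binary.PropositionalEquality
  open import Relation.Nullary using (yes; no; does)
  open import Data.Empty using (⊥-elim)

  private variable
    a b : Level
    A B : Set a

  concatMap-unique : {xs : List A} (f : A → List B) → Unique xs →
                     (∀ {x} → x ∈ xs → Unique (f x)) →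
                     (∀ {x y z} → x ∈ xs → y ∈ xs → z ∈ f x → z ∈ f y → x ≡ y) →
                     Unique (concatMap f xs)
  concatMap-unique {xs = []}     f []           uf disj = []
  concatMap-unique {xs = x ∷ xs} f (x∉xs ∷ uxs) uf disj =
    Unique.++⁺ (uf (here refl)) (concatMap-unique f uxs (uf ∘ there) (λ p q → disj (there p) (there q)))
      head-disjoint
    where
    head-disjoint : Disjoint (f x) (concatMap f xs)
    head-disjoint (z∈fx , z∈rest) with find (∈-concatMap⁻ f {xs = xs} z∈rest)
    ... | y , y∈xs , z∈fy = All.lookup x∉xs y∈xs (disj (here refl) (there y∈xs) z∈fx z∈fy)

  allVecs-complete : (xs : List A) (n : ℕ) (v : Vec A n) → (∀ i → lookup v i ∈ xs) → v ∈ allVecs xs n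
  allVecs-complete xs zero    []      _   = here refl
  allVecs-complete xs (suc n) (x ∷ v) v⊆xs =
    ∈-concatMap⁺ (λ z → map (z ∷_) (allVecs xs n))
      (Any.map (λ x≡y → subst (λ z → x ∷ v ∈ map (z ∷_) (allVecs xs n)) x≡y
                              (∈-map⁺ (x ∷_) (allVecs-complete xs n v (v⊆xs ∘ Fin.suc))))
               (v⊆xs Fin.zero))

  allVecs-unique : {xs : List A} → Unique xs → ∀ n → Unique (allVecs xs n)
  allVecs-unique uxs zero    = [] ∷ []
  allVecs-unique {xs = xs} uxs (suc n) =
    concatMap-unique _ uxs (λ _ → Unique.map⁺ ∷-injectiveʳ (allVecs-unique uxs n)) heads-differ
    where
    heads-differ : ∀ {x y z} → x ∈ xs → y ∈ xs →
                   z ∈ map (x ∷_) (allVecs xs n) → z ∈ map (y ∷_) (allVecs xs n) → x ≡ y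
    heads-differ _ _ p q with ∈-map⁻ _ p | ∈-map⁻ _ q
    ... | _ , _ , refl | _ , _ , e = ∷-injectiveˡ e

  isPerm⇔injective : ∀ {n} (π : Perm n) → isPerm π ≡ true ⇔ Injective _≡_ _≡_ (lookup π)
  isPerm⇔injective {n} π = mk⇔
    (λ h {i} {j} → entry-true i j (All.lookup (row-true i (rows-true h)) (∈-allFin j)))
    (λ inj → Equivalence.to T-≡ (All.all⁻ row {xs = allFin n} (All.tabulate λ {i} _ →
       All.all⁻ (entry i) {xs = allFin n} (All.tabulate λ {j} _ → Equivalence.from T-≡ (entry-inj inj i j)))))
    where
    entry : Fin n → Fin n → Bool
    entry i j = if does (lookup π i ≟ lookup π j) then does (i ≟ j) else true

    row : Fin n → Bool
    row i = all (entry i) (allFin n)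

    rows-true : isPerm π ≡ true → All.All (T ∘ row) (allFin n)
    rows-true h = All.all⁺ row (allFin n) (Equivalence.from T-≡ h)

    row-true : ∀ i → All.All (T ∘ row) (allFin n) → All.All (T ∘ entry i) (allFin n)
    row-true i h = All.all⁺ (entry i) (allFin n) (All.lookup h (∈-allFin i))

    entry-true : ∀ i j → T (entry i j) → lookup π i ≡ lookup π j → i ≡ j
    entry-true i j t e with lookup π i ≟ lookup π j | i ≟ j
    ... | yes _ | yes i≡j = i≡j
    ... | yes _ | no _    = ⊥-elim t
    ... | no π≢ | _       = ⊥-elim (π≢ e)

    entry-inj : Injective _≡_ _≡_ (lookup π) → ∀ i j → entry i j ≡ true
    entry-inj inj i j with lookup π i ≟ lookup π j | i ≟ j
    ... | yes _ | yes _   = refl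
    ... | yes e | no i≢j  = ⊥-elim (i≢j (inj e))
    ... | no _  | _       = refl

  ∣_∣ : ∀ {n} → SPerm n → Fin n → Fin n
  ∣ σ ∣ i = proj₂ (lookup σ i)

  lookup-absPerm : ∀ {n} (σ : SPerm n) i → lookup (absPerm σ) i ≡ ∣ σ ∣ i
  lookup-absPerm σ i = lookup-map i proj₂ σ

  SignedInjective : ∀ {n} → SPerm n → Set
  SignedInjective σ = Injective _≡_ _≡_ ∣ σ ∣

  absPerm-injective : ∀ {n} {σ : SPerm n} → SignedInjective σ → Injective _≡_ _≡_ (lookup (absPerm σ))
  absPerm-injective {σ = σ} inj {i} {j} e = inj (trans (sym (lookup-absPerm σ i)) (trans e (lookup-absPerm σ j)))

  signs : List Bool
  signs = true ∷ false ∷ []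

  signs-unique : Unique signs
  signs-unique = ((λ ()) ∷ []) ∷ [] ∷ []

  ∈-signs : ∀ b → b ∈ signs
  ∈-signs true  = here refl
  ∈-signs false = there (here refl)

  signedValues : ∀ n → List (Bool × Fin n)
  signedValues n = concatMap (λ b → map (b ,_) (allFin n)) signs

  signedValues-unique : ∀ n → Unique (signedValues n)
  signedValues-unique n =
    concatMap-unique _ signs-unique (λ _ → Unique.map⁺ (cong proj₂) (Unique.allFin⁺ n)) signs-differ
    where
    signs-differ : ∀ {b c z} → b ∈ signs → c ∈ signs →
                   z ∈ map (b ,_) (allFin n) → z ∈ map (c ,_) (allFin n) → b ≡ c
    signs-differ _ _ p q with ∈-map⁻ _ p | ∈-map⁻ _ q
    ... | _ , _ , refl | _ , _ , e = cong proj₁ e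

  ∈-signedValues : ∀ n (v : Bool × Fin n) → v ∈ signedValues n
  ∈-signedValues n (b , i) = ∈-concatMap⁺ (λ c → map (c ,_) (allFin n))
    (Any.map (λ b≡c → subst (λ c → (b , i) ∈ map (c ,_) (allFin n)) b≡c (∈-map⁺ (b ,_) (∈-allFin i)))
             (∈-signs b))

  ∈-Sn⁺ : ∀ {n} {π : Perm n} → Injective _≡_ _≡_ (lookup π) → π ∈ Sn n
  ∈-Sn⁺ {n} {π} inj = ∈-filter⁺ (λ v → isPerm v ≟ᵇ true)
    (allVecs-complete (allFin n) n π (λ _ → ∈-allFin _)) (Equivalence.from (isPerm⇔injective π) inj)

  ∈-Sn⁻ : ∀ {n} {π : Perm n} → π ∈ Sn n → Injective _≡_ _≡_ (lookup π)
  ∈-Sn⁻ {n} {π} π∈ = Equivalence.to (isPerm⇔injective π)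
    (proj₂ (∈-filter⁻ (λ v → isPerm v ≟ᵇ true) {xs = allVecs (allFin n) n} π∈))

  Sn-unique : ∀ n → Unique (Sn n)
  Sn-unique n = Unique.filter⁺ (λ v → isPerm v ≟ᵇ true) (allVecs-unique (Unique.allFin⁺ n) n)

  ∈-SBn⁺ : ∀ {n} {σ : SPerm n} → SignedInjective σ → σ ∈ SBn n
  ∈-SBn⁺ {n} {σ} inj = ∈-filter⁺ (λ σ → isPerm (absPerm σ) ≟ᵇ true)
    (allVecs-complete (signedValues n) n σ (λ _ → ∈-signedValues n _))
    (Equivalence.from (isPerm⇔injective (absPerm σ))
       (λ {i} {j} e → inj (trans (sym (lookup-absPerm σ i)) (trans e (lookup-absPerm σ j)))))

  ∈-SBn⁻ : ∀ {n} {σ : SPerm n} → σ ∈ SBn n → SignedInjective σ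
  ∈-SBn⁻ {n} {σ} σ∈ {i} {j} e = Equivalence.to (isPerm⇔injective (absPerm σ))
    (proj₂ (∈-filter⁻ (λ σ → isPerm (absPerm σ) ≟ᵇ true) {xs = allVecs (signedValues n) n} σ∈))
    (trans (lookup-absPerm σ i) (trans e (sym (lookup-absPerm σ j))))

  SBn-unique : ∀ n → Unique (SBn n)
  SBn-unique n = Unique.filter⁺ (λ σ → isPerm (absPerm σ) ≟ᵇ true)
    (allVecs-unique (signedValues-unique n) n)

open Enumeration

module Sums {c ℓ : Level} (R : CommutativeRing c ℓ) where
  open import Data.List using (List; []; _∷_; map; concatMap; _++_)
  open import Data.List.Membership.Propositional using (_∈_)
  open import Data.List.Relation.Unary.Any using (here; there)
  open import Data.List.Relation.Binary.Permutation.Propositional as ↭ using (_↭_)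
  import Relation.Binary.PropositionalEquality as ≡
  open CommutativeRing R
  open Eval R
  open import Relation.Binary.Reasoning.Setoid setoid
  open import Algebra.Properties.CommutativeSemigroup +-commutativeSemigroup using (x∙yz≈y∙xz)

  private variable
    a : Level
    X Y : Set a

  Σ-cong-∈ : (L : List X) {f g : X → Carrier} → (∀ x → x ∈ L → f x ≈ g x) → Σ L f ≈ Σ L g
  Σ-cong-∈ []      eq = refl
  Σ-cong-∈ (x ∷ L) eq = +-cong (eq x (here ≡.refl)) (Σ-cong-∈ L (λ y y∈L → eq y (there y∈L)))

  Σ-cong : (L : List X) {f g : X → Carrier} → (∀ x → f x ≈ g x) → Σ L f ≈ Σ L g
  Σ-cong L eq = Σ-cong-∈ L (λ x _ → eq x)

  Σ-++ : (L M : List X) (f : X → Carrier) → Σ (L ++ M) f ≈ Σ L f + Σ M f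
  Σ-++ []      M f = sym (+-identityˡ _)
  Σ-++ (x ∷ L) M f = begin
    f x + Σ (L ++ M) f    ≈⟨ +-congˡ (Σ-++ L M f) ⟩
    f x + (Σ L f + Σ M f) ≈⟨ +-assoc _ _ _ ⟨
    f x + Σ L f + Σ M f   ∎

  Σ-concatMap : (L : List X) (g : X → List Y) (f : Y → Carrier) →
                Σ (concatMap g L) f ≈ Σ L (λ x → Σ (g x) f)
  Σ-concatMap []      g f = refl
  Σ-concatMap (x ∷ L) g f = begin
    Σ (g x ++ concatMap g L) f      ≈⟨ Σ-++ (g x) (concatMap g L) f ⟩
    Σ (g x) f + Σ (concatMap g L) f ≈⟨ +-congˡ (Σ-concatMap L g f) ⟩
    Σ (g x) f + Σ L (λ x → Σ (g x) f) ∎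

  Σ-map : (L : List X) (g : X → Y) (f : Y → Carrier) → Σ (map g L) f ≈ Σ L (λ x → f (g x))
  Σ-map []      g f = refl
  Σ-map (x ∷ L) g f = +-congˡ (Σ-map L g f)

  Σ-↭ : {L M : List X} (f : X → Carrier) → L ↭ M → Σ L f ≈ Σ M f
  Σ-↭ f ↭.refl           = refl
  Σ-↭ f (↭.prep x p)     = +-congˡ (Σ-↭ f p)
  Σ-↭ {L = _ ∷ _ ∷ L} {M = _ ∷ _ ∷ M} f (↭.swap x y p) = begin
    f x + (f y + Σ L f) ≈⟨ +-assoc _ _ _ ⟨
    f x + f y + Σ L f   ≈⟨ +-cong (+-comm _ _) (Σ-↭ f p) ⟩
    f y + f x + Σ M f   ≈⟨ +-assoc _ _ _ ⟩
    f y + (f x + Σ M f) ∎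
  Σ-↭ f (↭.trans p q)    = trans (Σ-↭ f p) (Σ-↭ f q)

  Σ-+ : (L : List X) (f g : X → Carrier) → Σ L (λ x → f x + g x) ≈ Σ L f + Σ L g
  Σ-+ []      f g = sym (+-identityˡ _)
  Σ-+ (x ∷ L) f g = begin
    f x + g x + Σ L (λ x → f x + g x) ≈⟨ +-congˡ (Σ-+ L f g) ⟩
    f x + g x + (Σ L f + Σ L g)       ≈⟨ +-assoc _ _ _ ⟩
    f x + (g x + (Σ L f + Σ L g))     ≈⟨ +-congˡ (x∙yz≈y∙xz _ _ _) ⟩
    f x + (Σ L f + (g x + Σ L g))     ≈⟨ +-assoc _ _ _ ⟨
    f x + Σ L f + (g x + Σ L g)       ∎

  Σ-*ˡ : (L : List X) (u : Carrier) (f : X → Carrier) → Σ L (λ x → u * f x) ≈ u * Σ L f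
  Σ-*ˡ []      u f = sym (zeroʳ u)
  Σ-*ˡ (x ∷ L) u f = trans (+-congˡ (Σ-*ˡ L u f)) (sym (distribˡ u _ _))

  Σ-zero : (L : List X) → Σ L (λ _ → 0#) ≈ 0#
  Σ-zero []      = refl
  Σ-zero (x ∷ L) = trans (+-identityˡ _) (Σ-zero L)

  Σ-swap : (L : List X) (M : List Y) (f : X → Y → Carrier) →
           Σ L (λ x → Σ M (f x)) ≈ Σ M (λ y → Σ L (λ x → f x y))
  Σ-swap []      M f = sym (Σ-zero M)
  Σ-swap (x ∷ L) M f = begin
    Σ M (f x) + Σ L (λ x → Σ M (f x))          ≈⟨ +-congˡ (Σ-swap L M f) ⟩
    Σ M (f x) + Σ M (λ y → Σ L (λ x → f x y))  ≈⟨ Σ-+ M (f x) _ ⟨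
    Σ M (λ y → f x y + Σ L (λ x → f x y))      ∎

module Factorisation where

  open import Data.Bool using (Bool)
  open import Data.List using (List; map; concatMap)
  open import Data.List.Membership.Propositional using (_∈_; find)
  open import Data.List.Membership.Propositional.Properties using (∈-map⁺; ∈-map⁻; ∈-concatMap⁺; ∈-concatMap⁻)
  import Data.List.Relation.Unary.Any as Any
  open import Data.List.Relation.Unary.Unique.Propositional using (Unique)
  import Data.List.Relation.Unary.Unique.Propositional.Properties as Unique
  open import Data.List.Relation.Binary.Permutation.Propositional using (_↭_)
  open import Data.Vec using (Vec; lookup; zip)
  import Data.Vec as Vec
  open import Data.Vec.Properties using (map-proj₁-zip; map-proj₂-zip; map-<,>-zip; map-id; lookup-zip)
  open import Data.Product using (_,_; proj₁; proj₂)
  open import Relation.Binary.PropositionalEquality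

  signedPerms : ∀ n → List (SPerm n)
  signedPerms n = concatMap (λ π → map (λ ε → zip ε π) (allVecs signs n)) (Sn n)

  unzip-zip : ∀ {n} (σ : SPerm n) → zip (Vec.map proj₁ σ) (absPerm σ) ≡ σ
  unzip-zip σ = trans (sym (map-<,>-zip proj₁ proj₂ σ)) (map-id σ)

  abs-zip : ∀ {n} (ε : Vec Bool n) (π : Perm n) i → ∣ zip ε π ∣ i ≡ lookup π i
  abs-zip ε π i = cong proj₂ (lookup-zip i ε π)

  SBn-↭-signedPerms : ∀ n → SBn n ↭ signedPerms n
  SBn-↭-signedPerms n = unique-↭ (SBn-unique n) signedPerms-unique SBn⊆ ⊆SBn
    where
    signings : Perm n → List (SPerm n)
    signings π = map (λ ε → zip ε π) (allVecs signs n)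

    signedPerms-unique : Unique (signedPerms n)
    signedPerms-unique = concatMap-unique signings (Sn-unique n)
      (λ {π} _ → Unique.map⁺ (λ {ε} {ε′} e → trans (sym (map-proj₁-zip ε π))
                                             (trans (cong (Vec.map proj₁) e) (map-proj₁-zip ε′ π)))
                             (allVecs-unique signs-unique n))
      signings-disjoint
      where
      signings-disjoint : ∀ {π π′ σ} → π ∈ Sn n → π′ ∈ Sn n → σ ∈ signings π → σ ∈ signings π′ → π ≡ π′
      signings-disjoint {π} {π′} _ _ p q with ∈-map⁻ (λ ε → zip ε π) p | ∈-map⁻ (λ ε → zip ε π′) q
      ... | ε , _ , refl | ε′ , _ , e =
        trans (sym (map-proj₂-zip ε π)) (trans (cong absPerm e) (map-proj₂-zip ε′ π′))

    SBn⊆ : ∀ {σ} → σ ∈ SBn n → σ ∈ signedPerms n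
    SBn⊆ {σ} σ∈ = ∈-concatMap⁺ signings
      (Any.map (λ {π} e → subst (λ π → σ ∈ signings π) e
                 (subst (_∈ signings (absPerm σ)) (unzip-zip σ)
                    (∈-map⁺ (λ ε → zip ε (absPerm σ)) (allVecs-complete signs n _ (λ _ → ∈-signs _)))))
               (∈-Sn⁺ (absPerm-injective {σ = σ} (∈-SBn⁻ σ∈))))

    ⊆SBn : ∀ {σ} → σ ∈ signedPerms n → σ ∈ SBn n
    ⊆SBn σ∈ with find (∈-concatMap⁻ signings {xs = Sn n} σ∈)
    ... | π , π∈ , σ∈′ with ∈-map⁻ (λ ε → zip ε π) σ∈′
    ... | ε , _ , refl = ∈-SBn⁺ (λ {i} {j} e →
      ∈-Sn⁻ π∈ (trans (sym (abs-zip ε π i)) (trans e (abs-zip ε π j))))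

open Factorisation

module Statistics where

  open import Data.Bool using (Bool; not; _∧_)
  open import Data.Nat using (ℕ; _+_; _∸_; _<ᵇ_; _<?_)
  open import Data.Nat.Properties using (<-cmp; m+n∸m≡n)
  open import Data.Fin using (Fin; toℕ; _≟_)
  open import Data.Fin.Properties using (toℕ-injective)
  open import Data.Vec using (Vec; lookup; zip)
  open import Data.Vec.Properties using (map-proj₂-zip; lookup-zip)
  open import Data.Product using (_,_; proj₁; proj₂)
  open import Relation.Binary.Definitions using (tri<; tri≈; tri>)
  open import Relation.Binary.PropositionalEquality as ≡ using (_≡_)
  open import Relation.Nullary using (does)
  open import Relation.Nullary.Decidable using (dec-true; dec-false)

  record Stats : Set where
    constructor stats
    field exc aexc single fix neg cyc : ℕ

  aexcA : ∀ {n} → Perm n → ℕ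
  aexcA {n} π = count n (λ i → toℕ (lookup π i) <ᵇ toℕ i)

  statsB statsA : ∀ {n} → SPerm n → Stats
  statsB σ = stats (excB σ) (aexcB σ) (singleB σ) (fixB σ) (negB σ) (cycB σ)
  statsA σ = stats (excA (absPerm σ)) (aexcA (absPerm σ)) (singleB σ) (fixB σ) (negB σ) (cycA (absPerm σ))

  excA+fixA+aexcA : ∀ {n} (π : Perm n) → excA π + (fixA π + aexcA π) ≡ n
  excA+fixA+aexcA {n} π = ≡.trans (≡.cong (excA π +_) (≡.sym (count-split n trichotomy))) (count-complement n _)
    where
    trichotomy : ∀ i → 𝟙 (not (toℕ i <ᵇ toℕ (lookup π i))) ≡
                       𝟙 (does (lookup π i ≟ i)) + 𝟙 (toℕ (lookup π i) <ᵇ toℕ i)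
    trichotomy i with <-cmp (toℕ i) (toℕ (lookup π i))
    ... | tri< i<πi i≢πi πi≮i
      rewrite dec-true (toℕ i <? toℕ (lookup π i)) i<πi
            | dec-false (lookup π i ≟ i) (λ e → i≢πi (≡.cong toℕ (≡.sym e)))
            | dec-false (toℕ (lookup π i) <? toℕ i) πi≮i = ≡.refl
    ... | tri≈ i≮πi i≡πi πi≮i
      rewrite dec-false (toℕ i <? toℕ (lookup π i)) i≮πi
            | dec-true (lookup π i ≟ i) (toℕ-injective (≡.sym i≡πi))
            | dec-false (toℕ (lookup π i) <? toℕ i) πi≮i = ≡.refl
    ... | tri> i≮πi i≢πi πi<i
      rewrite dec-false (toℕ i <? toℕ (lookup π i)) i≮πi
            | dec-false (lookup π i ≟ i) (λ e → i≢πi (≡.cong toℕ (≡.sym e)))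
            | dec-true (toℕ (lookup π i) <? toℕ i) πi<i = ≡.refl

  aexcA≡n∸excA∸fixA : ∀ {n} (π : Perm n) → aexcA π ≡ n ∸ excA π ∸ fixA π
  aexcA≡n∸excA∸fixA {n} π = ≡.sym (begin
    n ∸ excA π ∸ fixA π                            ≡⟨ ≡.cong (λ m → m ∸ excA π ∸ fixA π) (excA+fixA+aexcA π) ⟨
    excA π + (fixA π + aexcA π) ∸ excA π ∸ fixA π  ≡⟨ ≡.cong (_∸ fixA π) (m+n∸m≡n (excA π) _) ⟩
    fixA π + aexcA π ∸ fixA π                      ≡⟨ m+n∸m≡n (fixA π) _ ⟩
    aexcA π                                        ∎)
    where open ≡.≡-Reasoning

  fixedPoint : ∀ {n} → Perm n → Fin n → Bool
  fixedPoint π i = does (lookup π i ≟ i)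

  statsA-zip : ∀ {n} (ε : Vec Bool n) (π : Perm n) →
               statsA (zip ε π) ≡ stats (excA π) (aexcA π)
                                        (count n (λ i → lookup ε i ∧ fixedPoint π i))
                                        (count n (λ i → not (lookup ε i) ∧ fixedPoint π i))
                                        (count n (lookup ε)) (cycA π)
  statsA-zip {n} ε π = ≡.cong₂ (λ π′ (sg , fx , ng) → stats (excA π′) (aexcA π′) sg fx ng (cycA π′))
    (map-proj₂-zip ε π)
    (≡.cong₂ _,_ (count-cong n (λ i → ≡.cong (λ e → proj₁ e ∧ does (proj₂ e ≟ i)) (lookup-zip i ε π)))
      (≡.cong₂ _,_ (count-cong n (λ i → ≡.cong (λ e → not (proj₁ e) ∧ does (proj₂ e ≟ i)) (lookup-zip i ε π)))
                   (count-cong n (λ i → ≡.cong proj₁ (lookup-zip i ε π)))))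

open Statistics

module Weight {c ℓ : Level} (R : CommutativeRing c ℓ) (x y s t p q : CommutativeRing.Carrier R) where
  open import Data.Bool using (Bool; true; false; not; _∧_)
  open import Data.Nat using (ℕ; zero; suc; _∸_; _≤_)
  import Data.Nat as ℕ
  open import Data.Nat.Properties using (+-∸-assoc)
  open import Data.Fin using (Fin)
  import Data.Fin as Fin
  open import Data.List using (List; []; _∷_; map)
  open import Data.Vec using (Vec; []; _∷_; lookup; zip)
  open import Function using (_∘_)
  open import Relation.Binary.PropositionalEquality as ≡ using (_≡_)
  open CommutativeRing R
  open Eval R
  open Sums R
  open import Relation.Binary.Reasoning.Setoid setoid
  open import Algebra.Properties.CommutativeSemigroup *-commutativeSemigroup using (interchange; x∙yz≈y∙xz; xy∙z≈xz∙y)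

  ^-+ : ∀ u m k → u ^ (m ℕ.+ k) ≈ u ^ m * u ^ k
  ^-+ u zero    k = sym (*-identityˡ _)
  ^-+ u (suc m) k = trans (*-congˡ (^-+ u m k)) (sym (*-assoc _ _ _))

  weight : Stats → Carrier
  weight (stats e a sg fx ng cy) = x ^ e * y ^ a * s ^ sg * t ^ fx * p ^ ng * q ^ cy

  signFactor : Bool → Bool → Carrier
  signFactor fixed b = s ^ 𝟙 (b ∧ fixed) * t ^ 𝟙 (not b ∧ fixed) * p ^ 𝟙 b

  signWeight : ∀ {n} → (Fin n → Bool) → Vec Bool n → Carrier
  signWeight {n} fixed ε =
    s ^ count n (λ i → lookup ε i ∧ fixed i) * t ^ count n (λ i → not (lookup ε i) ∧ fixed i) * p ^ count n (lookup ε)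

  signWeight-∷ : ∀ {n} (fixed : Fin (suc n) → Bool) b (ε : Vec Bool n) →
                 signWeight fixed (b ∷ ε) ≈ signFactor (fixed Fin.zero) b * signWeight (fixed ∘ Fin.suc) ε
  signWeight-∷ {n} fixed b ε = begin
    signWeight fixed (b ∷ ε)
      ≡⟨ ≡.cong₂ (λ i j → s ^ i * t ^ j * p ^ count (suc n) (lookup (b ∷ ε)))
                 (count-suc n (λ i → lookup (b ∷ ε) i ∧ fixed i))
                 (count-suc n (λ i → not (lookup (b ∷ ε) i) ∧ fixed i)) ⟩
    s ^ (𝟙 (b ∧ f₀) ℕ.+ S) * t ^ (𝟙 (not b ∧ f₀) ℕ.+ T) * p ^ count (suc n) (lookup (b ∷ ε))
      ≡⟨ ≡.cong (λ k → s ^ (𝟙 (b ∧ f₀) ℕ.+ S) * t ^ (𝟙 (not b ∧ f₀) ℕ.+ T) * p ^ k)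
                (count-suc n (lookup (b ∷ ε))) ⟩
    s ^ (𝟙 (b ∧ f₀) ℕ.+ S) * t ^ (𝟙 (not b ∧ f₀) ℕ.+ T) * p ^ (𝟙 b ℕ.+ N)
      ≈⟨ *-cong (*-cong (^-+ s (𝟙 (b ∧ f₀)) S) (^-+ t (𝟙 (not b ∧ f₀)) T)) (^-+ p (𝟙 b) N) ⟩
    (s ^ 𝟙 (b ∧ f₀) * s ^ S) * (t ^ 𝟙 (not b ∧ f₀) * t ^ T) * (p ^ 𝟙 b * p ^ N)
      ≈⟨ trans (*-congʳ (interchange _ _ _ _)) (interchange _ _ _ _) ⟩
    signFactor f₀ b * signWeight (fixed ∘ Fin.suc) ε
      ∎
    where
    f₀ : Bool
    f₀ = fixed Fin.zero
    S T N : ℕ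
    S = count n (λ i → lookup ε i ∧ fixed (Fin.suc i))
    T = count n (λ i → not (lookup ε i) ∧ fixed (Fin.suc i))
    N = count n (lookup ε)

  t+sp 1+p : Carrier
  t+sp = t + s * p
  1+p  = 1# + p

  signFactor-sum : ∀ n fixed c → c ≤ n →
                   (signFactor fixed true + signFactor fixed false) * (t+sp ^ c * 1+p ^ (n ∸ c)) ≈
                   t+sp ^ (𝟙 fixed ℕ.+ c) * 1+p ^ (suc n ∸ (𝟙 fixed ℕ.+ c))
  signFactor-sum n true c c≤n = begin
    ((s * 1#) * 1# * (p * 1#) + 1# * (t * 1#) * 1#) * (t+sp ^ c * 1+p ^ (n ∸ c))
      ≈⟨ *-congʳ (+-cong (*-cong (trans (*-identityʳ _) (*-identityʳ _)) (*-identityʳ _))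
                         (trans (*-identityʳ _) (trans (*-identityˡ _) (*-identityʳ _)))) ⟩
    (s * p + t) * (t+sp ^ c * 1+p ^ (n ∸ c)) ≈⟨ *-congʳ (+-comm _ _) ⟩
    t+sp * (t+sp ^ c * 1+p ^ (n ∸ c))       ≈⟨ *-assoc _ _ _ ⟨
    t+sp ^ suc c * 1+p ^ (n ∸ c)             ∎
  signFactor-sum n false c c≤n = begin
    (1# * 1# * (p * 1#) + 1# * 1# * 1#) * (t+sp ^ c * 1+p ^ (n ∸ c))
      ≈⟨ *-congʳ (+-cong (trans (*-congʳ (*-identityˡ _)) (trans (*-identityˡ _) (*-identityʳ _)))
                         (trans (*-identityʳ _) (*-identityˡ _))) ⟩
    (p + 1#) * (t+sp ^ c * 1+p ^ (n ∸ c))   ≈⟨ *-congʳ (+-comm _ _) ⟩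
    1+p * (t+sp ^ c * 1+p ^ (n ∸ c))        ≈⟨ x∙yz≈y∙xz _ _ _ ⟩
    t+sp ^ c * 1+p ^ suc (n ∸ c)            ≡⟨ ≡.cong (λ m → t+sp ^ c * 1+p ^ m) (+-∸-assoc 1 c≤n) ⟨
    t+sp ^ c * 1+p ^ (suc n ∸ c)            ∎

  Σ-signWeight : ∀ n (fixed : Fin n → Bool) →
                 Σ (allVecs signs n) (signWeight fixed) ≈ t+sp ^ count n fixed * 1+p ^ (n ∸ count n fixed)
  Σ-signWeight zero    fixed = trans (+-identityʳ _) (*-identityʳ _)
  Σ-signWeight (suc n) fixed = begin
    Σ (allVecs signs (suc n)) (signWeight fixed)
      ≈⟨ Σ-concatMap signs (λ b → map (b ∷_) rest) (signWeight fixed) ⟩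
    Σ signs (λ b → Σ (map (b ∷_) rest) (signWeight fixed))
      ≈⟨ Σ-cong signs (λ b → trans (Σ-map rest (b ∷_) (signWeight fixed))
                              (trans (Σ-cong rest (signWeight-∷ fixed b)) (Σ-*ˡ rest _ _))) ⟩
    signFactor f₀ true * X + (signFactor f₀ false * X + 0#)
      ≈⟨ trans (+-congˡ (+-identityʳ _)) (sym (distribʳ _ _ _)) ⟩
    (signFactor f₀ true + signFactor f₀ false) * X
      ≈⟨ *-congˡ (Σ-signWeight n (fixed ∘ Fin.suc)) ⟩
    (signFactor f₀ true + signFactor f₀ false) * (t+sp ^ m * 1+p ^ (n ∸ m))
      ≈⟨ signFactor-sum n f₀ m (count≤ n (fixed ∘ Fin.suc)) ⟩
    t+sp ^ (𝟙 f₀ ℕ.+ m) * 1+p ^ (suc n ∸ (𝟙 f₀ ℕ.+ m))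
      ≡⟨ ≡.cong (λ j → t+sp ^ j * 1+p ^ (suc n ∸ j)) (count-suc n fixed) ⟨
    t+sp ^ count (suc n) fixed * 1+p ^ (suc n ∸ count (suc n) fixed)
      ∎
    where
    rest : List (Vec Bool n)
    rest = allVecs signs n
    f₀ : Bool
    f₀ = fixed Fin.zero
    X : Carrier
    X = Σ rest (signWeight (fixed ∘ Fin.suc))
    m : ℕ
    m = count n (fixed ∘ Fin.suc)

  weight-statsA-zip : ∀ {n} (ε : Vec Bool n) (π : Perm n) →
                      weight (statsA (zip ε π)) ≈ (x ^ excA π * y ^ aexcA π * q ^ cycA π) * signWeight (fixedPoint π) ε
  weight-statsA-zip ε π = trans (reflexive (≡.cong weight (statsA-zip ε π))) (regroup _ _ _ _ _ _)
    where
    regroup : ∀ a b c d e f → a * b * c * d * e * f ≈ (a * b * f) * (c * d * e)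
    regroup a b c d e f = trans (*-congʳ (trans (*-congʳ (*-assoc (a * b) c d)) (*-assoc (a * b) (c * d) e)))
                                (xy∙z≈xz∙y (a * b) (c * d * e) f)

  Σ-signings : ∀ {n} (π : Perm n) →
               Σ (allVecs signs n) (λ ε → weight (statsA (zip ε π))) ≈
               x ^ excA π * y ^ (n ∸ excA π ∸ fixA π) * t+sp ^ fixA π * 1+p ^ (n ∸ fixA π) * q ^ cycA π
  Σ-signings {n} π = begin
    Σ signings (λ ε → weight (statsA (zip ε π)))  ≈⟨ Σ-cong signings (λ ε → weight-statsA-zip ε π) ⟩
    Σ signings (λ ε → K * signWeight (fixedPoint π) ε) ≈⟨ Σ-*ˡ signings K _ ⟩
    K * Σ signings (signWeight (fixedPoint π))    ≈⟨ *-congˡ (Σ-signWeight n (fixedPoint π)) ⟩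
    K * (t+sp ^ fixA π * 1+p ^ (n ∸ fixA π))      ≈⟨ regroup _ _ _ _ _ ⟩
    x ^ excA π * y ^ aexcA π * t+sp ^ fixA π * 1+p ^ (n ∸ fixA π) * q ^ cycA π
      ≡⟨ ≡.cong (λ m → x ^ excA π * y ^ m * t+sp ^ fixA π * 1+p ^ (n ∸ fixA π) * q ^ cycA π)
                (aexcA≡n∸excA∸fixA π) ⟩
    x ^ excA π * y ^ (n ∸ excA π ∸ fixA π) * t+sp ^ fixA π * 1+p ^ (n ∸ fixA π) * q ^ cycA π
      ∎
    where
    signings : List (Vec Bool n)
    signings = allVecs signs n
    K : Carrier
    K = x ^ excA π * y ^ aexcA π * q ^ cycA π
    regroup : ∀ a b c d e → (a * b * c) * (d * e) ≈ a * b * d * e * c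
    regroup a b c d e = trans (xy∙z≈xz∙y (a * b) c (d * e)) (*-congʳ (sym (*-assoc (a * b) d e)))

  Σ-weight-statsA : ∀ n → Σ (SBn n) (weight ∘ statsA) ≈ RHS n x y s t p q
  Σ-weight-statsA n = begin
    Σ (SBn n) (weight ∘ statsA)        ≈⟨ Σ-↭ (weight ∘ statsA) (SBn-↭-signedPerms n) ⟩
    Σ (signedPerms n) (weight ∘ statsA) ≈⟨ Σ-concatMap (Sn n) _ (weight ∘ statsA) ⟩
    Σ (Sn n) (λ π → Σ (map (λ ε → zip ε π) (allVecs signs n)) (weight ∘ statsA))
      ≈⟨ Σ-cong (Sn n) (λ π → trans (Σ-map (allVecs signs n) (λ ε → zip ε π) (weight ∘ statsA))
                                    (Σ-signings π)) ⟩
    RHS n x y s t p q                   ∎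

module Insertion where

  open import Data.Bool using (Bool; if_then_else_)
  open import Data.Nat using (ℕ; zero; suc)
  open import Data.Fin using (Fin; inject₁; fromℕ; _≟_; lower₁)
  import Data.Fin as Fin
  open import Data.Fin.Properties using (inject₁-injective; fromℕ≢inject₁; toℕ-injective; toℕ-fromℕ; inject₁-lower₁)
  open import Data.Maybe using (Maybe; just; nothing)
  open import Data.Vec using (Vec; []; _∷_; lookup; _∷ʳ_; _[_]≔_; tabulate)
  import Data.Vec as Vec
  open import Data.Vec.Properties using (lookup-map; lookup∘updateAt; lookup∘updateAt′; lookup∘tabulate)
  open import Data.Vec.Relation.Binary.Pointwise.Extensional using (ext; Pointwise-≡⇒≡)
  open import Data.Product using (_×_; _,_; proj₁; proj₂; Σ-syntax)
  open import Function using (_∘_)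
  open import Function.Definitions using (Injective)
  open import Relation.Binary.PropositionalEquality
  open import Relation.Nullary using (yes; no; does)
  open import Relation.Nullary.Decidable using (dec-true; dec-false)
  open import Data.Empty using (⊥-elim)
  open import Data.List using (List; []; _∷_; map; concatMap; allFin)
  open import Data.List.Membership.Propositional using (_∈_; find)
  open import Data.List.Membership.Propositional.Properties using (∈-allFin; ∈-map⁺; ∈-map⁻; ∈-concatMap⁺; ∈-concatMap⁻)
  open import Data.List.Relation.Unary.Any using (here; there)
  import Data.List.Relation.Unary.Any as Any
  import Data.List.Relation.Unary.All as All
  open import Data.List.Relation.Unary.AllPairs using (_∷_)
  open import Data.List.Relation.Unary.Unique.Propositional using (Unique)
  import Data.List.Relation.Unary.Unique.Propositional.Properties as Unique
  open import Data.List.Relation.Binary.Permutation.Propositional using (_↭_)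
  open import Data.Maybe.Properties using (just-injective)
  open import Data.Fin.Permutation.Components using (transpose; transpose-inverse)

  private variable
    n : ℕ

  data LastView {n : ℕ} : Fin (suc n) → Set where
    old : (j : Fin n) → LastView (inject₁ j)
    new : LastView (fromℕ n)

  lastView : ∀ {n} (i : Fin (suc n)) → LastView i
  lastView {zero}  Fin.zero    = new
  lastView {suc n} Fin.zero    = old Fin.zero
  lastView {suc n} (Fin.suc i) with lastView i
  ... | old j = old (Fin.suc j)
  ... | new   = new

  lookup-∷ʳ-inject₁ : ∀ {a} {A : Set a} (xs : Vec A n) x i → lookup (xs ∷ʳ x) (inject₁ i) ≡ lookup xs i
  lookup-∷ʳ-inject₁ (y ∷ xs) x Fin.zero    = refl
  lookup-∷ʳ-inject₁ (y ∷ xs) x (Fin.suc i) = lookup-∷ʳ-inject₁ xs x i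

  lookup-∷ʳ-fromℕ : ∀ {a} {A : Set a} (xs : Vec A n) x → lookup (xs ∷ʳ x) (fromℕ n) ≡ x
  lookup-∷ʳ-fromℕ []       x = refl
  lookup-∷ʳ-fromℕ (y ∷ xs) x = lookup-∷ʳ-fromℕ xs x

  inject₁≢fromℕ : (m : Fin n) → inject₁ m ≢ fromℕ n
  inject₁≢fromℕ m e = fromℕ≢inject₁ (sym e)

  lift : Bool × Fin n → Bool × Fin (suc n)
  lift (b , j) = b , inject₁ j

  lift-injective : {u v : Bool × Fin n} → lift u ≡ lift v → u ≡ v
  lift-injective {u = b , i} {c , j} e = cong₂ _,_ (cong proj₁ e) (inject₁-injective (cong proj₂ e))

  Choice : ℕ → Set
  Choice n = Maybe (Fin n) × Bool

  -- (nothing , δ) makes ±(n+1) a cycle of its own, (just k , δ) puts it right after ∣σ∣ k in the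
  -- cycle through k; δ is its sign (true = negative).
  insert : SPerm n → Choice n → SPerm (suc n)
  insert {n} σ (nothing , δ) = Vec.map lift σ ∷ʳ (δ , fromℕ n)
  insert {n} σ (just k , δ)  = (Vec.map lift σ [ ∣ σ ∣ k ]≔ (δ , fromℕ n)) ∷ʳ lift (lookup σ (∣ σ ∣ k))

  module _ (σ : SPerm n) where
    private
      relabelled : Fin n → Bool → Vec (Bool × Fin (suc n)) n
      relabelled k δ = Vec.map lift σ [ ∣ σ ∣ k ]≔ (δ , fromℕ n)

    insert-nothing-inject₁ : ∀ δ m → lookup (insert σ (nothing , δ)) (inject₁ m) ≡ lift (lookup σ m)
    insert-nothing-inject₁ δ m = trans (lookup-∷ʳ-inject₁ (Vec.map lift σ) _ m) (lookup-map m lift σ)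

    insert-nothing-fromℕ : ∀ δ → lookup (insert σ (nothing , δ)) (fromℕ n) ≡ (δ , fromℕ n)
    insert-nothing-fromℕ δ = lookup-∷ʳ-fromℕ (Vec.map lift σ) _

    insert-just-hit : ∀ k δ → lookup (insert σ (just k , δ)) (inject₁ (∣ σ ∣ k)) ≡ (δ , fromℕ n)
    insert-just-hit k δ =
      trans (lookup-∷ʳ-inject₁ (relabelled k δ) _ (∣ σ ∣ k)) (lookup∘updateAt (∣ σ ∣ k) (Vec.map lift σ))

    insert-just-inject₁ : ∀ k δ m → m ≢ ∣ σ ∣ k →
                          lookup (insert σ (just k , δ)) (inject₁ m) ≡ lift (lookup σ m)
    insert-just-inject₁ k δ m m≢i = trans (lookup-∷ʳ-inject₁ (relabelled k δ) _ m)
      (trans (lookup∘updateAt′ m (∣ σ ∣ k) m≢i (Vec.map lift σ)) (lookup-map m lift σ))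

    insert-just-fromℕ : ∀ k δ → lookup (insert σ (just k , δ)) (fromℕ n) ≡ lift (lookup σ (∣ σ ∣ k))
    insert-just-fromℕ k δ = lookup-∷ʳ-fromℕ (relabelled k δ) _

    insert-just≗insert-nothing∘transpose :
      ∀ k δ q → lookup (insert σ (just k , δ)) q ≡
                lookup (insert σ (nothing , δ)) (transpose (inject₁ (∣ σ ∣ k)) (fromℕ n) q)
    insert-just≗insert-nothing∘transpose k δ q with lastView q
    ... | new rewrite dec-false (fromℕ n ≟ inject₁ (∣ σ ∣ k)) (fromℕ≢inject₁)
                    | dec-true (fromℕ n ≟ fromℕ n) refl
      = trans (insert-just-fromℕ k δ) (sym (insert-nothing-inject₁ δ (∣ σ ∣ k)))
    ... | old m with m ≟ ∣ σ ∣ k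
    ...   | yes refl rewrite dec-true (inject₁ m ≟ inject₁ m) refl
      = trans (insert-just-hit k δ) (sym (insert-nothing-fromℕ δ))
    ...   | no m≢i rewrite dec-false (inject₁ m ≟ inject₁ (∣ σ ∣ k)) (m≢i ∘ inject₁-injective)
                         | dec-false (inject₁ m ≟ fromℕ n) (inject₁≢fromℕ m)
      = trans (insert-just-inject₁ k δ m m≢i) (sym (insert-nothing-inject₁ δ m))

    insert-signedInjective : SignedInjective σ → ∀ c → SignedInjective (insert σ c)
    insert-signedInjective inj (nothing , δ) {q₁} {q₂} e with lastView q₁ | lastView q₂
    ... | old m₁ | old m₂ = cong inject₁ (inj (inject₁-injective
            (trans (cong proj₂ (sym (insert-nothing-inject₁ δ m₁)))
                   (trans e (cong proj₂ (insert-nothing-inject₁ δ m₂))))))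
    ... | old m₁ | new    = ⊥-elim (inject₁≢fromℕ (∣ σ ∣ m₁)
            (trans (cong proj₂ (sym (insert-nothing-inject₁ δ m₁)))
                   (trans e (cong proj₂ (insert-nothing-fromℕ δ)))))
    ... | new    | old m₂ = ⊥-elim (inject₁≢fromℕ (∣ σ ∣ m₂)
            (trans (cong proj₂ (sym (insert-nothing-inject₁ δ m₂)))
                   (trans (sym e) (cong proj₂ (insert-nothing-fromℕ δ)))))
    ... | new    | new    = refl
    insert-signedInjective inj (just k , δ) {q₁} {q₂} e =
      transpose-injective (insert-signedInjective inj (nothing , δ)
        (trans (cong proj₂ (sym (insert-just≗insert-nothing∘transpose k δ q₁)))
               (trans e (cong proj₂ (insert-just≗insert-nothing∘transpose k δ q₂)))))
      where
      transpose-injective : ∀ {a b x y : Fin (suc n)} → transpose a b x ≡ transpose a b y → x ≡ y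
      transpose-injective {a} {b} {x} {y} t =
        trans (sym (transpose-inverse b a)) (trans (cong (transpose b a) t) (transpose-inverse b a))

  vec-ext : ∀ {a} {A : Set a} {xs ys : Vec A n} → (∀ i → lookup xs i ≡ lookup ys i) → xs ≡ ys
  vec-ext eq = Pointwise-≡⇒≡ (ext eq)

  insert-injective : ∀ {σ σ′ : SPerm n} {c c′} → SignedInjective σ →
                     insert σ c ≡ insert σ′ c′ → σ ≡ σ′ × c ≡ c′
  insert-injective {n} {σ} {σ′} {nothing , δ} {nothing , δ′} _ e =
    vec-ext (λ m → lift-injective (trans (sym (insert-nothing-inject₁ σ δ m))
                                  (trans (cong (λ v → lookup v (inject₁ m)) e) (insert-nothing-inject₁ σ′ δ′ m)))) ,
    cong (nothing ,_) (cong proj₁ (trans (sym (insert-nothing-fromℕ σ δ))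
                                  (trans (cong (λ v → lookup v (fromℕ n)) e) (insert-nothing-fromℕ σ′ δ′))))
  insert-injective {n} {σ} {σ′} {nothing , δ} {just k′ , δ′} _ e =
    ⊥-elim (inject₁≢fromℕ _ (cong proj₂ (trans (sym (insert-just-fromℕ σ′ k′ δ′))
                            (trans (cong (λ v → lookup v (fromℕ n)) (sym e)) (insert-nothing-fromℕ σ δ)))))
  insert-injective {n} {σ} {σ′} {just k , δ} {nothing , δ′} _ e =
    ⊥-elim (inject₁≢fromℕ _ (cong proj₂ (trans (sym (insert-just-fromℕ σ k δ))
                            (trans (cong (λ v → lookup v (fromℕ n)) e) (insert-nothing-fromℕ σ′ δ′)))))
  insert-injective {n} {σ} {σ′} {just k , δ} {just k′ , δ′} inj e =
    σ≡σ′ , cong₂ (λ k δ → just k , δ) k≡k′ δ≡δ′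
    where
    i i′ : Fin n
    i = ∣ σ ∣ k
    i′ = ∣ σ′ ∣ k′
    at : ∀ q → lookup (insert σ (just k , δ)) q ≡ lookup (insert σ′ (just k′ , δ′)) q
    at q = cong (λ v → lookup v q) e
    hit : (δ , fromℕ n) ≡ lookup (insert σ′ (just k′ , δ′)) (inject₁ i)
    hit = trans (sym (insert-just-hit σ k δ)) (at (inject₁ i))
    i≡i′ : i ≡ i′
    i≡i′ with i ≟ i′
    ... | yes i≡i′ = i≡i′
    ... | no i≢i′  =
      ⊥-elim (inject₁≢fromℕ _ (sym (cong proj₂ (trans hit (insert-just-inject₁ σ′ k′ δ′ i i≢i′)))))
    δ≡δ′ : δ ≡ δ′
    δ≡δ′ = cong proj₁ (trans hit (trans (cong (λ j → lookup (insert σ′ (just k′ , δ′)) (inject₁ j)) i≡i′)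
                                        (insert-just-hit σ′ k′ δ′)))
    σ≡σ′ : σ ≡ σ′
    σ≡σ′ = vec-ext agree
      where
      agree : ∀ m → lookup σ m ≡ lookup σ′ m
      agree m with m ≟ i
      ... | yes refl = lift-injective (trans (sym (insert-just-fromℕ σ k δ)) (trans (at (fromℕ n))
                         (trans (insert-just-fromℕ σ′ k′ δ′) (cong (lift ∘ lookup σ′) (sym i≡i′)))))
      ... | no m≢i   = lift-injective (trans (sym (insert-just-inject₁ σ k δ m m≢i)) (trans (at (inject₁ m))
                         (insert-just-inject₁ σ′ k′ δ′ m (λ m≡i′ → m≢i (trans m≡i′ (sym i≡i′))))))
    k≡k′ : k ≡ k′
    k≡k′ = inj (trans i≡i′ (cong (λ τ → ∣ τ ∣ k′) (sym σ≡σ′)))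

  lower : (e : Bool × Fin (suc n)) → proj₂ e ≢ fromℕ n → Bool × Fin n
  lower {n} (b , j) j≢n = b , lower₁ j (λ n≡j → j≢n (toℕ-injective (trans (sym n≡j) (sym (toℕ-fromℕ n)))))

  lift-lower : (e : Bool × Fin (suc n)) (p : proj₂ e ≢ fromℕ n) → lift (lower e p) ≡ e
  lift-lower (b , j) p = cong (b ,_) (inject₁-lower₁ j _)

  module Removal (σ′ : SPerm (suc n)) (inj′ : SignedInjective σ′) where

    -- Removing n+1 from its cycle: the entry pointing to ±(n+1) takes over the value σ′(n+1).
    source : Fin n → Fin (suc n)
    source m = if does (∣ σ′ ∣ (inject₁ m) ≟ fromℕ n) then fromℕ n else inject₁ m

    source-hit : ∀ m → ∣ σ′ ∣ (inject₁ m) ≡ fromℕ n → source m ≡ fromℕ n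
    source-hit m hit rewrite dec-true (∣ σ′ ∣ (inject₁ m) ≟ fromℕ n) hit = refl

    source-miss : ∀ m → ∣ σ′ ∣ (inject₁ m) ≢ fromℕ n → source m ≡ inject₁ m
    source-miss m miss rewrite dec-false (∣ σ′ ∣ (inject₁ m) ≟ fromℕ n) miss = refl

    source-avoids-fromℕ : ∀ m → ∣ σ′ ∣ (source m) ≢ fromℕ n
    source-avoids-fromℕ m with ∣ σ′ ∣ (inject₁ m) ≟ fromℕ n
    ... | yes hit = λ ℓ↦ℓ → inject₁≢fromℕ m (inj′ (trans hit (sym ℓ↦ℓ)))
    ... | no miss = miss

    source-injective : Injective _≡_ _≡_ source
    source-injective {m₁} {m₂} e with ∣ σ′ ∣ (inject₁ m₁) ≟ fromℕ n | ∣ σ′ ∣ (inject₁ m₂) ≟ fromℕ n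
    ... | yes hit₁ | yes hit₂ = inject₁-injective (inj′ (trans hit₁ (sym hit₂)))
    ... | yes _    | no _     = ⊥-elim (inject₁≢fromℕ m₂ (sym e))
    ... | no _     | yes _    = ⊥-elim (inject₁≢fromℕ m₁ e)
    ... | no _     | no _     = inject₁-injective e

    removal : SPerm n
    removal = tabulate (λ m → lower (lookup σ′ (source m)) (source-avoids-fromℕ m))

    lift-removal : ∀ m → lift (lookup removal m) ≡ lookup σ′ (source m)
    lift-removal m = trans (cong lift (lookup∘tabulate _ m)) (lift-lower _ (source-avoids-fromℕ m))

    removal-signedInjective : SignedInjective removal
    removal-signedInjective {m₁} {m₂} e = source-injective (inj′
      (trans (cong proj₂ (sym (lift-removal m₁))) (trans (cong inject₁ e) (cong proj₂ (lift-removal m₂)))))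

    insert-removal : Σ[ c ∈ Choice n ] insert removal c ≡ σ′
    insert-removal with ∣ σ′ ∣ (fromℕ n) in ℓ↦
    ... | j with lastView j
    ...   | new = (nothing , proj₁ (lookup σ′ (fromℕ n))) , vec-ext agree
      where
      agree : ∀ q → lookup (insert removal (nothing , proj₁ (lookup σ′ (fromℕ n)))) q ≡ lookup σ′ q
      agree q with lastView q
      ... | old m = trans (insert-nothing-inject₁ removal _ m) (trans (lift-removal m)
                      (cong (lookup σ′) (source-miss m (λ hit → inject₁≢fromℕ m (inj′ (trans hit (sym ℓ↦)))))))
      ... | new   = trans (insert-nothing-fromℕ removal _) (cong (proj₁ (lookup σ′ (fromℕ n)) ,_) (sym ℓ↦))
    ...   | old j₀ with injective⇒surjective inj′ (fromℕ n)
    ...     | i′ , i′↦ℓ with lastView i′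
    ...       | new    = ⊥-elim (inject₁≢fromℕ j₀ (trans (sym ℓ↦) i′↦ℓ))
    ...       | old i₀ with injective⇒surjective removal-signedInjective i₀
    ...         | k , k↦i₀ = (just k , δ) , vec-ext agree
      where
      δ : Bool
      δ = proj₁ (lookup σ′ (inject₁ i₀))
      agree : ∀ q → lookup (insert removal (just k , δ)) q ≡ lookup σ′ q
      agree q with lastView q
      ... | new = trans (insert-just-fromℕ removal k δ)
                    (trans (cong (λ m → lift (lookup removal m)) k↦i₀)
                    (trans (lift-removal i₀) (cong (lookup σ′) (source-hit i₀ i′↦ℓ))))
      ... | old m with m ≟ ∣ removal ∣ k
      ...   | yes refl = trans (insert-just-hit removal k δ)
                           (trans (cong (δ ,_) (sym i′↦ℓ)) (cong (lookup σ′ ∘ inject₁) (sym k↦i₀)))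
      ...   | no m≢i   = trans (insert-just-inject₁ removal k δ m m≢i) (trans (lift-removal m)
                           (cong (lookup σ′) (source-miss m (λ hit → m≢i
                             (trans (inject₁-injective (inj′ (trans hit (sym i′↦ℓ)))) (sym k↦i₀))))))

  choices : ∀ n → List (Choice n)
  choices n = concatMap (λ mk → map (mk ,_) signs) (nothing ∷ map just (allFin n))

  choices-unique : ∀ n → Unique (choices n)
  choices-unique n = concatMap-unique (λ mk → map (mk ,_) signs) positions-unique
    (λ {mk} _ → Unique.map⁺ {f = mk ,_} (cong proj₂) signs-unique) positions-differ
    where
    nothing∉justs : ∀ {mk} → mk ∈ map just (allFin n) → nothing ≢ mk
    nothing∉justs mk∈ with ∈-map⁻ just mk∈
    ... | _ , _ , refl = λ ()
    positions-unique : Unique (nothing ∷ map just (allFin n))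
    positions-unique = All.tabulate nothing∉justs ∷ Unique.map⁺ just-injective (Unique.allFin⁺ n)
    positions-differ : ∀ {x y z} → x ∈ nothing ∷ map just (allFin n) → y ∈ nothing ∷ map just (allFin n) →
                       z ∈ map (x ,_) signs → z ∈ map (y ,_) signs → x ≡ y
    positions-differ {x} {y} _ _ p q with ∈-map⁻ (x ,_) p | ∈-map⁻ (y ,_) q
    ... | _ , _ , refl | _ , _ , e = cong proj₁ e

  ∈-choices : ∀ n (c : Choice n) → c ∈ choices n
  ∈-choices n (mk , δ) = ∈-concatMap⁺ (λ mk → map (mk ,_) signs)
    (Any.map (λ mk≡ → subst (λ z → (mk , δ) ∈ map (z ,_) signs) mk≡ (∈-map⁺ (mk ,_) (∈-signs δ)))
             (position∈ mk))
    where
    position∈ : ∀ mk → mk ∈ nothing ∷ map just (allFin n)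
    position∈ nothing  = here refl
    position∈ (just k) = there (∈-map⁺ just (∈-allFin k))

  insertions : ∀ n → List (SPerm (suc n))
  insertions n = concatMap (λ σ → map (insert σ) (choices n)) (SBn n)

  SBn-suc-↭-insertions : ∀ n → SBn (suc n) ↭ insertions n
  SBn-suc-↭-insertions n = unique-↭ (SBn-unique (suc n)) insertions-unique SBn-suc⊆ ⊆SBn-suc
    where
    insertions-unique : Unique (insertions n)
    insertions-unique = concatMap-unique (λ σ → map (insert σ) (choices n)) (SBn-unique n)
      (λ σ∈ → Unique.map⁺ (λ {c} {c′} e → proj₂ (insert-injective {c = c} {c′} (∈-SBn⁻ σ∈) e))
                          (choices-unique n))
      insertions-differ
      where
      insertions-differ : ∀ {σ σ′ τ} → σ ∈ SBn n → σ′ ∈ SBn n →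
                          τ ∈ map (insert σ) (choices n) → τ ∈ map (insert σ′) (choices n) → σ ≡ σ′
      insertions-differ {σ} {σ′} σ∈ _ p q
        with ∈-map⁻ (insert σ) {xs = choices n} p | ∈-map⁻ (insert σ′) {xs = choices n} q
      ... | c , _ , refl | c′ , _ , e = proj₁ (insert-injective {c = c} {c′} (∈-SBn⁻ σ∈) e)

    SBn-suc⊆ : ∀ {σ′} → σ′ ∈ SBn (suc n) → σ′ ∈ insertions n
    SBn-suc⊆ {σ′} σ′∈ with Removal.insert-removal σ′ (∈-SBn⁻ σ′∈)
    ... | c , e = ∈-concatMap⁺ (λ σ → map (insert σ) (choices n))
      (Any.map (λ σ≡ → subst (λ τ → σ′ ∈ map (insert τ) (choices n)) σ≡
                         (subst (_∈ map (insert σ) (choices n)) e (∈-map⁺ (insert σ) (∈-choices n c))))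
               (∈-SBn⁺ (Removal.removal-signedInjective σ′ (∈-SBn⁻ σ′∈))))
      where
      σ : SPerm n
      σ = Removal.removal σ′ (∈-SBn⁻ σ′∈)

    ⊆SBn-suc : ∀ {σ′} → σ′ ∈ insertions n → σ′ ∈ SBn (suc n)
    ⊆SBn-suc σ′∈ with find (∈-concatMap⁻ (λ σ → map (insert σ) (choices n)) {xs = SBn n} σ′∈)
    ... | σ , σ∈ , σ′∈σ with ∈-map⁻ (insert σ) {xs = choices n} σ′∈σ
    ... | c , _ , refl = ∈-SBn⁺ (insert-signedInjective σ (∈-SBn⁻ σ∈) c)

open Insertion

module SignedStats where

  open import Data.Bool using (Bool; true; false; not; _∧_)
  open import Data.Bool.Properties using (∧-identityʳ; ∧-zeroʳ)
  open import Data.Nat using (ℕ; suc; _+_; _<_; s<s)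
  open import Data.Nat.Properties using (+-assoc; +-identityʳ; <-asym; suc-injective; +-commutativeSemigroup)
  open import Algebra.Properties.CommutativeSemigroup +-commutativeSemigroup using (xy∙z≈xz∙y)
  open import Data.Fin using (Fin; inject₁; fromℕ; toℕ; _≟_)
  open import Data.Fin.Properties using (toℕ-inject₁; toℕ-fromℕ; toℕ<n; inject₁-injective; fromℕ≢inject₁; toℕ-injective)
  open import Data.Integer using (ℤ; -[1+_]; -<-; -<+; +<+) renaming (_<?_ to _<ℤ?_)
  import Data.Integer as ℤ
  import Data.Integer.Properties as ℤᵖ
  open import Relation.Binary.Definitions using (tri<; tri≈; tri>)
  open import Data.Empty using (⊥-elim)
  open import Data.Maybe using (just; nothing)
  open import Data.Vec using (lookup)
  open import Data.Product using (_×_; _,_; proj₁; proj₂)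
  open import Function using (_∘_; flip)
  open import Relation.Binary.PropositionalEquality
  open import Relation.Nullary using (yes; no; does; Dec)
  open import Relation.Nullary.Decidable using (dec-true; dec-false)

  private variable
    n : ℕ

  value next : SPerm n → Fin n → ℤ
  value ρ m = sval (lookup ρ m)
  next  ρ m = sval (lookup ρ (∣ ρ ∣ m))

  toℕ<toℕ-fromℕ : (j : Fin n) → toℕ j < toℕ (fromℕ n)
  toℕ<toℕ-fromℕ {n} j = subst (toℕ j <_) (sym (toℕ-fromℕ n)) (toℕ<n j)

  sval-lift : (u : Bool × Fin n) → sval (lift u) ≡ sval u
  sval-lift (true  , j) = cong -[1+_] (toℕ-inject₁ j)
  sval-lift (false , j) = cong (ℤ.+_ ∘ suc) (toℕ-inject₁ j)

  -- -(n+1) lies below and n+1 above every element of ±[n]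
  extreme-< : ∀ δ (u : Bool × Fin n) → does (sval (δ , fromℕ n) <ℤ? sval u) ≡ δ
  extreme-< {n} true  (true  , j) = dec-true (sval (true , fromℕ n) <ℤ? sval (true , j)) (-<- (toℕ<toℕ-fromℕ j))
  extreme-< {n} true  (false , j) = dec-true (sval (true , fromℕ n) <ℤ? sval (false , j)) -<+
  extreme-< {n} false (true  , j) = dec-false (sval (false , fromℕ n) <ℤ? sval (true , j)) λ ()
  extreme-< {n} false (false , j) = dec-false (sval (false , fromℕ n) <ℤ? sval (false , j))
    λ { (+<+ n<j) → <-asym n<j (s<s (toℕ<toℕ-fromℕ j)) }

  <-extreme : ∀ δ (u : Bool × Fin n) → does (sval u <ℤ? sval (δ , fromℕ n)) ≡ not δ
  <-extreme {n} true  (true  , j) = dec-false (sval (true , j) <ℤ? sval (true , fromℕ n))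
    λ { (-<- n<j) → <-asym n<j (toℕ<toℕ-fromℕ j) }
  <-extreme {n} true  (false , j) = dec-false (sval (false , j) <ℤ? sval (true , fromℕ n)) λ ()
  <-extreme {n} false (true  , j) = dec-true (sval (true , j) <ℤ? sval (false , fromℕ n)) -<+
  <-extreme {n} false (false , j) = dec-true (sval (false , j) <ℤ? sval (false , fromℕ n)) (+<+ (s<s (toℕ<toℕ-fromℕ j)))

  <-irreflexive : ∀ v → does (v <ℤ? v) ≡ false
  <-irreflexive v = dec-false (v <ℤ? v) (ℤᵖ.<-irrefl refl)

  sval-injective : (u v : Bool × Fin n) → sval u ≡ sval v → proj₂ u ≡ proj₂ v
  sval-injective (true  , j) (true  , j′) e = toℕ-injective (ℤᵖ.-[1+-injective e)
  sval-injective (false , j) (false , j′) e = toℕ-injective (suc-injective (ℤᵖ.+-injective e))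
  sval-injective (true  , j) (false , j′) ()
  sval-injective (false , j) (true  , j′) ()

  <-flip : ∀ {a b} → a ≢ b → does (b <ℤ? a) ≡ not (does (a <ℤ? b))
  <-flip {a} {b} a≢b with ℤᵖ.<-cmp a b
  ... | tri< a<b _ b≮a rewrite dec-true (a <ℤ? b) a<b | dec-false (b <ℤ? a) b≮a = refl
  ... | tri≈ _ a≡b _ = ⊥-elim (a≢b a≡b)
  ... | tri> a≮b _ b<a rewrite dec-false (a <ℤ? b) a≮b | dec-true (b <ℤ? a) b<a = refl

  module _ (σ : SPerm n) (inj : SignedInjective σ) where

    module NewCycle (δ : Bool) where
      σ′ : SPerm (suc n)
      σ′ = insert σ (nothing , δ)

      value-inject₁ : ∀ m → value σ′ (inject₁ m) ≡ value σ m
      value-inject₁ m = trans (cong sval (insert-nothing-inject₁ σ δ m)) (sval-lift _)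

      next-inject₁ : ∀ m → next σ′ (inject₁ m) ≡ next σ m
      next-inject₁ m = trans (cong (sval ∘ lookup σ′ ∘ proj₂) (insert-nothing-inject₁ σ δ m)) (value-inject₁ (∣ σ ∣ m))

      value≡next-fromℕ : value σ′ (fromℕ n) ≡ next σ′ (fromℕ n)
      value≡next-fromℕ = cong (sval ∘ lookup σ′ ∘ proj₂) (sym (insert-nothing-fromℕ σ δ))

    module After (k : Fin n) (δ : Bool) where
      i : Fin n
      i = ∣ σ ∣ k

      σ′ : SPerm (suc n)
      σ′ = insert σ (just k , δ)

      value-inject₁ : ∀ m → m ≢ i → value σ′ (inject₁ m) ≡ value σ m
      value-inject₁ m m≢i = trans (cong sval (insert-just-inject₁ σ k δ m m≢i)) (sval-lift _)

      next-inject₁ : ∀ m → m ≢ i → m ≢ k → next σ′ (inject₁ m) ≡ next σ m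
      next-inject₁ m m≢i m≢k = trans (cong (sval ∘ lookup σ′ ∘ proj₂) (insert-just-inject₁ σ k δ m m≢i))
                                     (value-inject₁ (∣ σ ∣ m) (m≢k ∘ inj))

      value-hit : value σ′ (inject₁ i) ≡ sval (δ , fromℕ n)
      value-hit = cong sval (insert-just-hit σ k δ)

      next-hit : next σ′ (inject₁ i) ≡ value σ i
      next-hit = trans (cong (sval ∘ lookup σ′ ∘ proj₂) (insert-just-hit σ k δ))
                       (trans (cong sval (insert-just-fromℕ σ k δ)) (sval-lift _))

      next-inject₁-k : i ≢ k → next σ′ (inject₁ k) ≡ sval (δ , fromℕ n)
      next-inject₁-k i≢k = trans (cong (sval ∘ lookup σ′ ∘ proj₂) (insert-just-inject₁ σ k δ k (i≢k ∘ sym))) value-hit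

      value-fromℕ : value σ′ (fromℕ n) ≡ value σ i
      value-fromℕ = trans (cong sval (insert-just-fromℕ σ k δ)) (sval-lift _)

      next-fromℕ : i ≢ k → next σ′ (fromℕ n) ≡ next σ i
      next-fromℕ i≢k = trans (cong (sval ∘ lookup σ′ ∘ proj₂) (insert-just-fromℕ σ k δ))
                             (value-inject₁ (∣ σ ∣ i) (i≢k ∘ inj))

      next-fromℕ-fixed : i ≡ k → next σ′ (fromℕ n) ≡ sval (δ , fromℕ n)
      next-fromℕ-fixed i≡k = trans (cong (sval ∘ lookup σ′ ∘ proj₂) (insert-just-fromℕ σ k δ))
                                   (trans (cong (λ m → value σ′ (inject₁ m)) (cong ∣ σ ∣ i≡k)) value-hit)

  comparisons : (ℤ → ℤ → Bool) → SPerm n → ℕ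
  comparisons {n} rel ρ = count n (λ m → rel (value ρ m) (next ρ m))

  module Comparisons (rel : ℤ → ℤ → Bool) (f : Bool → Bool)
    (extreme-rel : ∀ {n} δ (u : Bool × Fin n) → rel (sval (δ , fromℕ n)) (sval u) ≡ f δ)
    (rel-extreme : ∀ {n} δ (u : Bool × Fin n) → rel (sval u) (sval (δ , fromℕ n)) ≡ not (f δ))
    (rel-irrefl : ∀ v → rel v v ≡ false)
    (σ : SPerm n) (inj : SignedInjective σ) where

    private
      R : Fin n → Bool
      R m = rel (value σ m) (next σ m)

    comparisons-new-cycle : ∀ δ → comparisons rel (insert σ (nothing , δ)) ≡ comparisons rel σ
    comparisons-new-cycle δ = begin
      comparisons rel σ′
        ≡⟨ count-last n _ ⟩
      count n (λ m → rel (value σ′ (inject₁ m)) (next σ′ (inject₁ m))) +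
        𝟙 (rel (value σ′ (fromℕ n)) (next σ′ (fromℕ n)))
        ≡⟨ cong₂ _+_ (count-cong n (λ m → cong₂ rel (value-inject₁ m) (next-inject₁ m)))
                     (cong (λ v → 𝟙 (rel v (next σ′ (fromℕ n)))) value≡next-fromℕ) ⟩
      comparisons rel σ + 𝟙 (rel (next σ′ (fromℕ n)) (next σ′ (fromℕ n)))
        ≡⟨ cong (λ b → comparisons rel σ + 𝟙 b) (rel-irrefl _) ⟩
      comparisons rel σ + 0
        ≡⟨ +-identityʳ _ ⟩
      comparisons rel σ ∎
      where
      open ≡-Reasoning
      open NewCycle σ inj δ

    comparisons-after : ∀ k δ → comparisons rel (insert σ (just k , δ)) + 𝟙 (R k) ≡ comparisons rel σ + 1
    comparisons-after k δ with ∣ σ ∣ k ≟ k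
    ... | yes i≡k = begin
      comparisons rel σ′ + 𝟙 (R k)       ≡⟨ cong (_+ 𝟙 (R k)) (count-last n _) ⟩
      count n Q + 𝟙 (P′ (fromℕ n)) + 𝟙 (R k) ≡⟨ xy∙z≈xz∙y (count n Q) _ _ ⟩
      count n Q + 𝟙 (R k) + 𝟙 (P′ (fromℕ n)) ≡⟨ cong (_+ 𝟙 (P′ (fromℕ n))) (count-agree-except n k Q≈R) ⟩
      count n R + 𝟙 (Q k) + 𝟙 (P′ (fromℕ n)) ≡⟨ cong₂ (λ a b → count n R + 𝟙 a + 𝟙 b) Qk Pℓ ⟩
      count n R + 𝟙 (f δ) + 𝟙 (not (f δ))   ≡⟨ trans (+-assoc (count n R) _ _) (cong (count n R +_) (𝟙-not (f δ))) ⟩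
      count n R + 1                          ∎
      where
      open ≡-Reasoning
      open After σ inj k δ
      P′ : Fin (suc n) → Bool
      P′ m = rel (value σ′ m) (next σ′ m)
      Q : Fin n → Bool
      Q = P′ ∘ inject₁
      Q≈R : ∀ m → m ≢ k → Q m ≡ R m
      Q≈R m m≢k = cong₂ rel (value-inject₁ m (m≢k ∘ flip trans i≡k)) (next-inject₁ m (m≢k ∘ flip trans i≡k) m≢k)
      Qk : Q k ≡ f δ
      Qk = trans (cong Q (sym i≡k)) (trans (cong₂ rel value-hit next-hit) (extreme-rel δ _))
      Pℓ : P′ (fromℕ n) ≡ not (f δ)
      Pℓ = trans (cong₂ rel (trans value-fromℕ (cong (value σ) i≡k)) (next-fromℕ-fixed i≡k)) (rel-extreme δ _)
    ... | no i≢k = begin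
      comparisons rel σ′ + 𝟙 (R k)                  ≡⟨ cong (_+ 𝟙 (R k)) (count-last n _) ⟩
      count n Q + 𝟙 (P′ (fromℕ n)) + 𝟙 (R k)        ≡⟨ cong (λ b → count n Q + 𝟙 b + 𝟙 (R k)) Pℓ ⟩
      count n Q + 𝟙 (R i) + 𝟙 (R k)                 ≡⟨ count-agree-except₂ n i≢k Q≈R ⟩
      count n R + 𝟙 (Q i) + 𝟙 (Q k)                 ≡⟨ cong₂ (λ a b → count n R + 𝟙 a + 𝟙 b) Qi Qk ⟩
      count n R + 𝟙 (f δ) + 𝟙 (not (f δ))           ≡⟨ trans (+-assoc (count n R) _ _) (cong (count n R +_) (𝟙-not (f δ))) ⟩
      count n R + 1                                 ∎
      where
      open ≡-Reasoning
      open After σ inj k δ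
      P′ : Fin (suc n) → Bool
      P′ m = rel (value σ′ m) (next σ′ m)
      Q : Fin n → Bool
      Q = P′ ∘ inject₁
      Q≈R : ∀ m → m ≢ i → m ≢ k → Q m ≡ R m
      Q≈R m m≢i m≢k = cong₂ rel (value-inject₁ m m≢i) (next-inject₁ m m≢i m≢k)
      Qi : Q i ≡ f δ
      Qi = trans (cong₂ rel value-hit next-hit) (extreme-rel δ _)
      Qk : Q k ≡ not (f δ)
      Qk = trans (cong₂ rel (value-inject₁ k (i≢k ∘ sym)) (next-inject₁-k i≢k)) (rel-extreme δ _)
      Pℓ : P′ (fromℕ n) ≡ R i
      Pℓ = cong₂ rel value-fromℕ (next-fromℕ i≢k)

  inject₁-≟ : (a b : Fin n) → does (inject₁ a ≟ inject₁ b) ≡ does (a ≟ b)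
  inject₁-≟ a b with a ≟ b
  ... | yes refl = dec-true (inject₁ a ≟ inject₁ a) refl
  ... | no a≢b   = dec-false (inject₁ a ≟ inject₁ b) (a≢b ∘ inject₁-injective)

  signedFixedPoints : (Bool → Bool) → SPerm n → ℕ
  signedFixedPoints {n} g ρ = count n (λ m → g (proj₁ (lookup ρ m)) ∧ does (∣ ρ ∣ m ≟ m))

  module SignedFixedPoints (g : Bool → Bool) (σ : SPerm n) (inj : SignedInjective σ) where

    private
      F : Fin n → Bool
      F m = g (proj₁ (lookup σ m)) ∧ does (∣ σ ∣ m ≟ m)

    signedFixedPoints-new-cycle : ∀ δ → signedFixedPoints g (insert σ (nothing , δ)) ≡ signedFixedPoints g σ + 𝟙 (g δ)
    signedFixedPoints-new-cycle δ = trans (count-last n _) (cong₂ _+_ (count-cong n at-inject₁) (cong 𝟙 at-fromℕ))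
      where
      σ′ : SPerm (suc n)
      σ′ = insert σ (nothing , δ)
      at-inject₁ : ∀ m → g (proj₁ (lookup σ′ (inject₁ m))) ∧ does (∣ σ′ ∣ (inject₁ m) ≟ inject₁ m) ≡ F m
      at-inject₁ m rewrite insert-nothing-inject₁ σ δ m = cong (g (proj₁ (lookup σ m)) ∧_) (inject₁-≟ (∣ σ ∣ m) m)
      at-fromℕ : g (proj₁ (lookup σ′ (fromℕ n))) ∧ does (∣ σ′ ∣ (fromℕ n) ≟ fromℕ n) ≡ g δ
      at-fromℕ rewrite insert-nothing-fromℕ σ δ | dec-true (fromℕ n ≟ fromℕ n) refl = ∧-identityʳ (g δ)

    signedFixedPoints-after : ∀ k δ → signedFixedPoints g (insert σ (just k , δ)) + 𝟙 (F k) ≡ signedFixedPoints g σ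
    signedFixedPoints-after k δ = begin
      signedFixedPoints g σ′ + 𝟙 (F k)       ≡⟨ cong (_+ 𝟙 (F k)) (count-last n _) ⟩
      count n Q + 𝟙 (P′ (fromℕ n)) + 𝟙 (F k) ≡⟨ cong₂ (λ a b → count n Q + 𝟙 a + 𝟙 b) Pℓ Fk≡Fi ⟩
      count n Q + 0 + 𝟙 (F i)                ≡⟨ cong (_+ 𝟙 (F i)) (+-identityʳ _) ⟩
      count n Q + 𝟙 (F i)                    ≡⟨ count-agree-except n i Q≈F ⟩
      count n F + 𝟙 (Q i)                    ≡⟨ cong (λ b → count n F + 𝟙 b) Qi ⟩
      count n F + 0                          ≡⟨ +-identityʳ _ ⟩
      count n F                              ∎
      where
      open ≡-Reasoning
      open After σ inj k δ
      P′ : Fin (suc n) → Bool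
      P′ m = g (proj₁ (lookup σ′ m)) ∧ does (∣ σ′ ∣ m ≟ m)
      Q : Fin n → Bool
      Q = P′ ∘ inject₁
      Q≈F : ∀ m → m ≢ i → Q m ≡ F m
      Q≈F m m≢i rewrite insert-just-inject₁ σ k δ m m≢i = cong (g (proj₁ (lookup σ m)) ∧_) (inject₁-≟ (∣ σ ∣ m) m)
      Qi : Q i ≡ false
      Qi rewrite insert-just-hit σ k δ | dec-false (fromℕ n ≟ inject₁ i) fromℕ≢inject₁ = ∧-zeroʳ (g δ)
      Pℓ : P′ (fromℕ n) ≡ false
      Pℓ rewrite insert-just-fromℕ σ k δ | dec-false (inject₁ (∣ σ ∣ i) ≟ fromℕ n) (inject₁≢fromℕ _) = ∧-zeroʳ _
      Fk≡Fi : F k ≡ F i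
      Fk≡Fi = case-fixed (i ≟ k)
        where
        case-fixed : Dec (i ≡ k) → F k ≡ F i
        case-fixed (yes i≡k) = cong F (sym i≡k)
        case-fixed (no i≢k)  = trans (cong (g (proj₁ (lookup σ k)) ∧_) (dec-false (i ≟ k) i≢k))
                                 (trans (∧-zeroʳ _) (sym (trans (cong (g (proj₁ (lookup σ i)) ∧_)
                                                                 (dec-false (∣ σ ∣ i ≟ i) (i≢k ∘ inj))) (∧-zeroʳ _))))

  negatives : SPerm n → ℕ
  negatives {n} ρ = count n (proj₁ ∘ lookup ρ)

  module Negatives (σ : SPerm n) (inj : SignedInjective σ) where

    negatives-new-cycle : ∀ δ → negatives (insert σ (nothing , δ)) ≡ negatives σ + 𝟙 δ
    negatives-new-cycle δ = trans (count-last n _)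
      (cong₂ _+_ (count-cong n (cong proj₁ ∘ insert-nothing-inject₁ σ δ)) (cong (𝟙 ∘ proj₁) (insert-nothing-fromℕ σ δ)))

    negatives-after : ∀ k δ → negatives (insert σ (just k , δ)) ≡ negatives σ + 𝟙 δ
    negatives-after k δ = begin
      negatives σ′                             ≡⟨ count-last n _ ⟩
      count n Q + 𝟙 (proj₁ (lookup σ′ (fromℕ n))) ≡⟨ cong (λ e → count n Q + 𝟙 (proj₁ e)) (insert-just-fromℕ σ k δ) ⟩
      count n Q + 𝟙 (proj₁ (lookup σ i))       ≡⟨ count-agree-except n i (λ m m≢i → cong proj₁ (insert-just-inject₁ σ k δ m m≢i)) ⟩
      negatives σ + 𝟙 (Q i)                    ≡⟨ cong (λ e → negatives σ + 𝟙 (proj₁ e)) (insert-just-hit σ k δ) ⟩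
      negatives σ + 𝟙 δ                        ∎
      where
      open ≡-Reasoning
      open After σ inj k δ
      Q : Fin n → Bool
      Q = proj₁ ∘ lookup σ′ ∘ inject₁

open SignedStats

module Cycles where

  open import Data.Bool using (Bool; true; false)
  open import Data.Bool.Properties using (T-≡; ⇔→≡)
  open import Data.Nat using (ℕ; zero; suc; _+_; _∸_; _≤_; _<_)
  open import Data.Nat.Properties
    using (n<1+n; m<n⇒0<n∸m; m∸n≤m; ≤-trans; <⇒≤pred; +-comm; m∸n+n≡m; <⇒≤; <-≤-trans; m≤n⇒m<n∨m≡n;
           ≤-refl; <⇒≱; +-identityʳ; ≤ᵇ⇒≤; ≤⇒≤ᵇ)
  open import Data.Fin using (Fin; toℕ; inject₁; fromℕ; _≟_)
  open import Data.Fin.Properties using (pigeonhole; toℕ<n; toℕ-inject₁; toℕ-fromℕ)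
  open import Data.List using (upTo)
  open import Data.List.Membership.Propositional.Properties using (∈-upTo⁺)
  import Data.List.Relation.Unary.All as All
  import Data.List.Relation.Unary.All.Properties as All
  open import Data.Vec using (lookup)
  open import Data.Product using (_×_; _,_; ∃)
  open import Data.Sum using (_⊎_; inj₁; inj₂)
  open import Function using (_∘_; Equivalence; mk⇔)
  open import Function.Definitions using (Injective)
  open import Relation.Binary.PropositionalEquality
  open import Relation.Nullary using (yes; no)
  open import Data.Empty using (⊥-elim)

  private variable
    n : ℕ

  module _ (π : Perm n) (inj : Injective _≡_ _≡_ (lookup π)) where

    iter-+ : ∀ a b x → iter π (a + b) x ≡ iter π a (iter π b x)
    iter-+ zero    b x = refl
    iter-+ (suc a) b x = cong (lookup π) (iter-+ a b x)

    iter-injective : ∀ a {x y} → iter π a x ≡ iter π a y → x ≡ y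
    iter-injective zero    e = e
    iter-injective (suc a) e = iter-injective a (inj e)

    -- by pigeonhole two of the n+1 iterates π⁰ j, …, πⁿ j coincide
    period : ∀ j → ∃ λ p → 0 < p × p ≤ n × iter π p j ≡ j
    period j with pigeonhole (n<1+n n) (λ (a : Fin (suc n)) → iter π (toℕ a) j)
    ... | a , b , a<b , πᵃ≡πᵇ = toℕ b ∸ toℕ a , m<n⇒0<n∸m a<b ,
          ≤-trans (m∸n≤m (toℕ b) (toℕ a)) (<⇒≤pred (toℕ<n b)) ,
          iter-injective (toℕ a) (begin
            iter π (toℕ a) (iter π (toℕ b ∸ toℕ a) j) ≡⟨ iter-+ (toℕ a) _ j ⟨
            iter π (toℕ a + (toℕ b ∸ toℕ a)) j        ≡⟨ cong (λ c → iter π c j) (trans (+-comm (toℕ a) _) (m∸n+n≡m (<⇒≤ a<b))) ⟩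
            iter π (toℕ b) j                          ≡⟨ πᵃ≡πᵇ ⟨
            iter π (toℕ a) j                          ∎)
      where open ≡-Reasoning

    iter-mod : ∀ j k → ∃ λ r → r < n × iter π k j ≡ iter π r j
    iter-mod j k with period j
    ... | p , 0<p , p≤n , πᵖj≡j = let (r , r<p , e) = reduce k in r , <-≤-trans r<p p≤n , e
      where
      reduce : ∀ k → ∃ λ r → r < p × iter π k j ≡ iter π r j
      reduce zero    = 0 , 0<p , refl
      reduce (suc k) with reduce k
      ... | r , r<p , e with m≤n⇒m<n∨m≡n r<p
      ...   | inj₁ r+1<p = suc r , r+1<p , cong (lookup π) e
      ...   | inj₂ r+1≡p = 0 , 0<p , trans (cong (lookup π) e) (trans (cong (λ c → iter π c j) r+1≡p) πᵖj≡j)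

    isCycleMin⇒minimal : ∀ j → isCycleMin π j ≡ true → ∀ k → toℕ j ≤ toℕ (iter π k j)
    isCycleMin⇒minimal j h k with iter-mod j k
    ... | r , r<n , e = subst (λ x → toℕ j ≤ toℕ x) (sym e)
      (≤ᵇ⇒≤ _ _ (All.lookup (All.all⁺ _ (upTo n) (Equivalence.from T-≡ h)) (∈-upTo⁺ r<n)))

  minimal⇒isCycleMin : (π : Perm n) (j : Fin n) → (∀ k → toℕ j ≤ toℕ (iter π k j)) → isCycleMin π j ≡ true
  minimal⇒isCycleMin {n} π j h = Equivalence.to T-≡ (All.all⁻ _ {xs = upTo n} (All.tabulate (λ {k} _ → ≤⇒≤ᵇ (h k))))

  cycA-add-fixed-point : (π : Perm n) (π′ : Perm (suc n)) →
                    Injective _≡_ _≡_ (lookup π) → Injective _≡_ _≡_ (lookup π′) →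
                    (∀ m → lookup π′ (inject₁ m) ≡ inject₁ (lookup π m)) → lookup π′ (fromℕ n) ≡ fromℕ n →
                    cycA π′ ≡ cycA π + 1
  cycA-add-fixed-point {n} π π′ inj inj′ π′-inject₁ π′-fromℕ =
    trans (count-last n (isCycleMin π′)) (cong₂ _+_ (count-cong n old-minima) (cong 𝟙 last-minimum))
    where
    orbit : ∀ j k → iter π′ k (inject₁ j) ≡ inject₁ (iter π k j)
    orbit j zero    = refl
    orbit j (suc k) = trans (cong (lookup π′) (orbit j k)) (π′-inject₁ _)

    toℕ-orbit : ∀ j k → toℕ (iter π′ k (inject₁ j)) ≡ toℕ (iter π k j)
    toℕ-orbit j k = trans (cong toℕ (orbit j k)) (toℕ-inject₁ _)

    old-minima : ∀ j → isCycleMin π′ (inject₁ j) ≡ isCycleMin π j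
    old-minima j = ⇔→≡ {z = true} (mk⇔
      (λ h → minimal⇒isCycleMin π j (λ k →
         subst₂ _≤_ (toℕ-inject₁ j) (toℕ-orbit j k) (isCycleMin⇒minimal π′ inj′ (inject₁ j) h k)))
      (λ h → minimal⇒isCycleMin π′ (inject₁ j) (λ k →
         subst₂ _≤_ (sym (toℕ-inject₁ j)) (sym (toℕ-orbit j k)) (isCycleMin⇒minimal π inj j h k))))

    last-fixed : ∀ k → iter π′ k (fromℕ n) ≡ fromℕ n
    last-fixed zero    = refl
    last-fixed (suc k) = trans (cong (lookup π′) (last-fixed k)) π′-fromℕ

    last-minimum : isCycleMin π′ (fromℕ n) ≡ true
    last-minimum = minimal⇒isCycleMin π′ (fromℕ n) (λ k → subst (λ x → toℕ (fromℕ n) ≤ toℕ x) (sym (last-fixed k)) ≤-refl)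

  cycA-splice : (π : Perm n) (π′ : Perm (suc n)) →
                    Injective _≡_ _≡_ (lookup π) → Injective _≡_ _≡_ (lookup π′) → (i : Fin n) →
                    (∀ m → m ≢ i → lookup π′ (inject₁ m) ≡ inject₁ (lookup π m)) →
                    lookup π′ (inject₁ i) ≡ fromℕ n → lookup π′ (fromℕ n) ≡ inject₁ (lookup π i) →
                    cycA π′ ≡ cycA π
  cycA-splice {n} π π′ inj inj′ i π′-inject₁ π′-hit π′-fromℕ =
    trans (count-last n (isCycleMin π′))
          (trans (cong₂ _+_ (count-cong n old-minima) (cong 𝟙 last-not-minimum)) (+-identityʳ _))
    where
    -- the π′-orbit of an old point is its π-orbit with n+1 spliced in after i
    orbit⊆ : ∀ j k → (∃ λ r → iter π′ k (inject₁ j) ≡ inject₁ (iter π r j)) ⊎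
                     (iter π′ k (inject₁ j) ≡ fromℕ n × ∃ λ r → i ≡ iter π r j)
    orbit⊆ j zero = inj₁ (0 , refl)
    orbit⊆ j (suc k) with orbit⊆ j k
    ... | inj₂ (e , r , i≡) = inj₁ (suc r , trans (cong (lookup π′) e) (trans π′-fromℕ (cong (inject₁ ∘ lookup π) i≡)))
    ... | inj₁ (r , e) with iter π r j ≟ i
    ...   | yes x≡i = inj₂ (trans (cong (lookup π′) e) (trans (cong (lookup π′ ∘ inject₁) x≡i) π′-hit) , r , sym x≡i)
    ...   | no x≢i  = inj₁ (suc r , trans (cong (lookup π′) e) (π′-inject₁ _ x≢i))

    orbit⊇ : ∀ j r → ∃ λ k → iter π′ k (inject₁ j) ≡ inject₁ (iter π r j)
    orbit⊇ j zero = 0 , refl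
    orbit⊇ j (suc r) with orbit⊇ j r
    ... | k , e with iter π r j ≟ i
    ...   | no x≢i  = suc k , trans (cong (lookup π′) e) (π′-inject₁ _ x≢i)
    ...   | yes x≡i = suc (suc k) , (begin
      lookup π′ (lookup π′ (iter π′ k (inject₁ j))) ≡⟨ cong (lookup π′ ∘ lookup π′) (trans e (cong inject₁ x≡i)) ⟩
      lookup π′ (lookup π′ (inject₁ i))             ≡⟨ cong (lookup π′) π′-hit ⟩
      lookup π′ (fromℕ n)                           ≡⟨ π′-fromℕ ⟩
      inject₁ (lookup π i)                          ≡⟨ cong (inject₁ ∘ lookup π) x≡i ⟨
      inject₁ (lookup π (iter π r j))               ∎)
      where open ≡-Reasoning

    old-minima : ∀ j → isCycleMin π′ (inject₁ j) ≡ isCycleMin π j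
    old-minima j = ⇔→≡ {z = true} (mk⇔
      (λ h → minimal⇒isCycleMin π j (λ r → let (k , e) = orbit⊇ j r in
         subst₂ _≤_ (toℕ-inject₁ j) (trans (cong toℕ e) (toℕ-inject₁ _)) (isCycleMin⇒minimal π′ inj′ (inject₁ j) h k)))
      (λ h → minimal⇒isCycleMin π′ (inject₁ j) (λ k → lower-bound h k (orbit⊆ j k))))
      where
      lower-bound : isCycleMin π j ≡ true → ∀ k →
                    (∃ λ r → iter π′ k (inject₁ j) ≡ inject₁ (iter π r j)) ⊎
                    (iter π′ k (inject₁ j) ≡ fromℕ n × ∃ λ r → i ≡ iter π r j) →
                    toℕ (inject₁ j) ≤ toℕ (iter π′ k (inject₁ j))
      lower-bound h k (inj₁ (r , e)) =
        subst₂ _≤_ (sym (toℕ-inject₁ j)) (sym (trans (cong toℕ e) (toℕ-inject₁ _))) (isCycleMin⇒minimal π inj j h r)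
      lower-bound h k (inj₂ (e , _)) =
        subst₂ _≤_ (sym (toℕ-inject₁ j)) (sym (trans (cong toℕ e) (toℕ-fromℕ n))) (<⇒≤ (toℕ<n j))

    last-not-minimum : isCycleMin π′ (fromℕ n) ≡ false
    last-not-minimum with isCycleMin π′ (fromℕ n) in minimal
    ... | false = refl
    ... | true  = ⊥-elim (<⇒≱ π′ℓ<ℓ (isCycleMin⇒minimal π′ inj′ (fromℕ n) minimal 1))
      where
      π′ℓ<ℓ : toℕ (lookup π′ (fromℕ n)) < toℕ (fromℕ n)
      π′ℓ<ℓ = subst₂ _<_ (sym (trans (cong toℕ π′-fromℕ) (toℕ-inject₁ _))) (sym (toℕ-fromℕ n)) (toℕ<n _)

open Cycles

module UnsignedStats where

  open import Data.Bool using (Bool; false; not)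
  open import Data.Nat using (ℕ; suc; _+_; _<ᵇ_; _<?_)
  open import Data.Nat.Properties using (+-assoc; +-identityʳ; +-commutativeSemigroup; <-cmp)
  open import Algebra.Properties.CommutativeSemigroup +-commutativeSemigroup using (xy∙z≈xz∙y)
  open import Data.Fin using (Fin; toℕ; inject₁; fromℕ)
  open import Data.Fin.Properties using (toℕ-inject₁; toℕ-fromℕ)
  open import Data.Maybe using (just; nothing)
  open import Data.Product using (_,_; proj₂)
  open import Function using (_∘_)
  open import Relation.Binary.PropositionalEquality
  open import Relation.Binary.Definitions using (tri<; tri≈; tri>)
  open import Relation.Nullary.Decidable using (dec-true; dec-false)
  open import Data.Empty using (⊥-elim)

  private variable
    n : ℕ

  positionComparisons : (ℕ → ℕ → Bool) → SPerm n → ℕ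
  positionComparisons {n} rel ρ = count n (λ m → rel (toℕ m) (toℕ (∣ ρ ∣ m)))

  module PositionComparisons (rel : ℕ → ℕ → Bool) (f : Bool)
    (rel-top : ∀ {n} (j : Fin n) → rel (toℕ j) n ≡ f)
    (top-rel : ∀ {n} (j : Fin n) → rel n (toℕ j) ≡ not f)
    (rel-irrefl : ∀ a → rel a a ≡ false)
    (σ : SPerm n) where

    private
      A : Fin n → Bool
      A m = rel (toℕ m) (toℕ (∣ σ ∣ m))

    positionComparisons-new-cycle : ∀ δ → positionComparisons rel (insert σ (nothing , δ)) ≡ positionComparisons rel σ
    positionComparisons-new-cycle δ = begin
      positionComparisons rel σ′ ≡⟨ count-last n _ ⟩
      count n (λ m → rel (toℕ (inject₁ m)) (toℕ (∣ σ′ ∣ (inject₁ m)))) +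
        𝟙 (rel (toℕ (fromℕ n)) (toℕ (∣ σ′ ∣ (fromℕ n))))
        ≡⟨ cong₂ _+_ (count-cong n at-inject₁) (cong 𝟙 at-fromℕ) ⟩
      positionComparisons rel σ + 0 ≡⟨ +-identityʳ _ ⟩
      positionComparisons rel σ ∎
      where
      open ≡-Reasoning
      σ′ : SPerm (suc n)
      σ′ = insert σ (nothing , δ)
      at-inject₁ : ∀ m → rel (toℕ (inject₁ m)) (toℕ (∣ σ′ ∣ (inject₁ m))) ≡ A m
      at-inject₁ m = cong₂ rel (toℕ-inject₁ m) (trans (cong (toℕ ∘ proj₂) (insert-nothing-inject₁ σ δ m)) (toℕ-inject₁ _))
      at-fromℕ : rel (toℕ (fromℕ n)) (toℕ (∣ σ′ ∣ (fromℕ n))) ≡ false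
      at-fromℕ = trans (cong (rel (toℕ (fromℕ n)) ∘ toℕ ∘ proj₂) (insert-nothing-fromℕ σ δ)) (rel-irrefl _)

    positionComparisons-after : ∀ k δ → positionComparisons rel (insert σ (just k , δ)) + 𝟙 (A (∣ σ ∣ k)) ≡
                                        positionComparisons rel σ + 1
    positionComparisons-after k δ = begin
      positionComparisons rel σ′ + 𝟙 (A i)    ≡⟨ cong (_+ 𝟙 (A i)) (count-last n _) ⟩
      count n Q + 𝟙 (P′ (fromℕ n)) + 𝟙 (A i) ≡⟨ xy∙z≈xz∙y (count n Q) _ _ ⟩
      count n Q + 𝟙 (A i) + 𝟙 (P′ (fromℕ n)) ≡⟨ cong (_+ 𝟙 (P′ (fromℕ n))) (count-agree-except n i Q≈A) ⟩
      count n A + 𝟙 (Q i) + 𝟙 (P′ (fromℕ n)) ≡⟨ cong₂ (λ a b → count n A + 𝟙 a + 𝟙 b) Qi Pℓ ⟩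
      count n A + 𝟙 f + 𝟙 (not f)            ≡⟨ trans (+-assoc (count n A) _ _) (cong (count n A +_) (𝟙-not f)) ⟩
      count n A + 1                          ∎
      where
      open ≡-Reasoning
      i : Fin n
      i = ∣ σ ∣ k
      σ′ : SPerm (suc n)
      σ′ = insert σ (just k , δ)
      P′ : Fin (suc n) → Bool
      P′ m = rel (toℕ m) (toℕ (∣ σ′ ∣ m))
      Q : Fin n → Bool
      Q = P′ ∘ inject₁
      Q≈A : ∀ m → m ≢ i → Q m ≡ A m
      Q≈A m m≢i = cong₂ rel (toℕ-inject₁ m) (trans (cong (toℕ ∘ proj₂) (insert-just-inject₁ σ k δ m m≢i)) (toℕ-inject₁ _))
      Qi : Q i ≡ f
      Qi = trans (cong₂ rel (toℕ-inject₁ i) (trans (cong (toℕ ∘ proj₂) (insert-just-hit σ k δ)) (toℕ-fromℕ n))) (rel-top i)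
      Pℓ : P′ (fromℕ n) ≡ not f
      Pℓ = trans (cong₂ rel (toℕ-fromℕ n) (trans (cong (toℕ ∘ proj₂) (insert-just-fromℕ σ k δ)) (toℕ-inject₁ _)))
                 (top-rel (∣ σ ∣ i))

  module _ (σ : SPerm n) (inj : SignedInjective σ) where

    cycles-new-cycle : ∀ δ → cycA (absPerm (insert σ (nothing , δ))) ≡ cycA (absPerm σ) + 1
    cycles-new-cycle δ = cycA-add-fixed-point (absPerm σ) (absPerm σ′)
      (absPerm-injective {σ = σ} inj) (absPerm-injective {σ = σ′} (insert-signedInjective σ inj (nothing , δ)))
      (λ m → trans (lookup-absPerm σ′ (inject₁ m))
                   (trans (cong proj₂ (insert-nothing-inject₁ σ δ m)) (cong inject₁ (sym (lookup-absPerm σ m)))))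
      (trans (lookup-absPerm σ′ (fromℕ n)) (cong proj₂ (insert-nothing-fromℕ σ δ)))
      where
      σ′ : SPerm (suc n)
      σ′ = insert σ (nothing , δ)

    cycles-after : ∀ k δ → cycA (absPerm (insert σ (just k , δ))) ≡ cycA (absPerm σ)
    cycles-after k δ = cycA-splice (absPerm σ) (absPerm σ′)
      (absPerm-injective {σ = σ} inj) (absPerm-injective {σ = σ′} (insert-signedInjective σ inj (just k , δ))) i
      (λ m m≢i → trans (lookup-absPerm σ′ (inject₁ m))
                       (trans (cong proj₂ (insert-just-inject₁ σ k δ m m≢i)) (cong inject₁ (sym (lookup-absPerm σ m)))))
      (trans (lookup-absPerm σ′ (inject₁ i)) (cong proj₂ (insert-just-hit σ k δ)))
      (trans (lookup-absPerm σ′ (fromℕ n))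
             (trans (cong proj₂ (insert-just-fromℕ σ k δ)) (cong inject₁ (sym (lookup-absPerm σ i)))))
      where
      i : Fin n
      i = ∣ σ ∣ k
      σ′ : SPerm (suc n)
      σ′ = insert σ (just k , δ)

  <ᵇ-flip : ∀ {a b} → a ≢ b → (b <ᵇ a) ≡ not (a <ᵇ b)
  <ᵇ-flip {a} {b} a≢b with <-cmp a b
  ... | tri< a<b _ b≮a rewrite dec-true (a <? b) a<b | dec-false (b <? a) b≮a = refl
  ... | tri≈ _ a≡b _ = ⊥-elim (a≢b a≡b)
  ... | tri> a≮b _ b<a rewrite dec-false (a <? b) a≮b | dec-true (b <? a) b<a = refl

  excA-absPerm : (ρ : SPerm n) → excA (absPerm ρ) ≡ positionComparisons _<ᵇ_ ρ
  excA-absPerm {n} ρ = count-cong n (λ m → cong (λ j → toℕ m <ᵇ toℕ j) (lookup-absPerm ρ m))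

  aexcA-absPerm : (ρ : SPerm n) → aexcA (absPerm ρ) ≡ positionComparisons (λ a b → b <ᵇ a) ρ
  aexcA-absPerm {n} ρ = count-cong n (λ m → cong (λ j → toℕ j <ᵇ toℕ m) (lookup-absPerm ρ m))

open UnsignedStats

module Kinds where

  open import Data.Bool using (Bool; true; false; not; _∧_)
  open import Data.Bool.Properties using (∧-zeroʳ)
  open import Data.Nat using (ℕ; suc; _+_; _∸_)
  open import Data.Nat.Properties using (+-identityʳ; +-comm; +-cancelʳ-≡; m+n∸n≡m)
  open import Data.Fin using (Fin)
  open import Data.Maybe using (just; nothing)
  open import Data.Product using (_×_; _,_)
  open import Relation.Binary.PropositionalEquality

  data Kind : Set where
    excedance anti-excedance fixed-point singleton : Kind

  _==_ : Kind → Kind → Bool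
  excedance      == excedance      = true
  anti-excedance == anti-excedance = true
  fixed-point    == fixed-point    = true
  singleton      == singleton      = true
  _              == _              = false

  classify : (fixed negative ascent : Bool) → Kind
  classify true  true  _     = singleton
  classify true  false _     = fixed-point
  classify false _     true  = excedance
  classify false _     false = anti-excedance

  classify-== : ∀ fixed negative ascent descent →
                (fixed ≡ true → ascent ≡ false × descent ≡ false) → (fixed ≡ false → descent ≡ not ascent) →
                (classify fixed negative ascent == excedance ≡ ascent) ×
                (classify fixed negative ascent == anti-excedance ≡ descent) ×
                (classify fixed negative ascent == fixed-point ≡ not negative ∧ fixed) ×
                (classify fixed negative ascent == singleton ≡ negative ∧ fixed)
  classify-== true  true  _     _ fixed⇒ _ with fixed⇒ refl
  ... | refl , refl = refl , refl , refl , refl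
  classify-== true  false _     _ fixed⇒ _ with fixed⇒ refl
  ... | refl , refl = refl , refl , refl , refl
  classify-== false neg   true  _ _ moving⇒ rewrite moving⇒ refl = refl , refl , sym (∧-zeroʳ (not neg)) , sym (∧-zeroʳ neg)
  classify-== false neg   false _ _ moving⇒ rewrite moving⇒ refl = refl , refl , sym (∧-zeroʳ (not neg)) , sym (∧-zeroʳ neg)

  newCycle : Bool → Stats → Stats
  newCycle δ (stats e a sg fx ng cy) = stats e a (sg + 𝟙 δ) (fx + 𝟙 (not δ)) (ng + 𝟙 δ) (cy + 1)

  -- fx ∸ 1 and sg ∸ 1 are only needed when the kind occurs, i.e. when fx (resp. sg) is positive
  afterKind : Kind → Bool → Stats → Stats
  afterKind excedance      δ (stats e a sg fx ng cy) = stats e       (suc a) sg       fx       (ng + 𝟙 δ) cy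
  afterKind anti-excedance δ (stats e a sg fx ng cy) = stats (suc e) a       sg       fx       (ng + 𝟙 δ) cy
  afterKind fixed-point    δ (stats e a sg fx ng cy) = stats (suc e) (suc a) sg       (fx ∸ 1) (ng + 𝟙 δ) cy
  afterKind singleton      δ (stats e a sg fx ng cy) = stats (suc e) (suc a) (sg ∸ 1) fx       (ng + 𝟙 δ) cy

  multiplicity : Kind → Stats → ℕ
  multiplicity excedance      = Stats.exc
  multiplicity anti-excedance = Stats.aexc
  multiplicity fixed-point    = Stats.fix
  multiplicity singleton      = Stats.single

  private
    kept : ∀ {x y} → x + 𝟙 true ≡ y + 1 → x ≡ y
    kept {x} {y} = +-cancelʳ-≡ 1 x y

    gained : ∀ {x y} → x + 𝟙 false ≡ y + 1 → x ≡ suc y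
    gained {x} {y} e = trans (sym (+-identityʳ x)) (trans e (+-comm y 1))

    lost : ∀ {x y} → x + 𝟙 true ≡ y → x ≡ y ∸ 1
    lost {x} refl = sym (m+n∸n≡m x 1)

    unchanged : ∀ {x y} → x + 𝟙 false ≡ y → x ≡ y
    unchanged {x} e = trans (sym (+-identityʳ x)) e

  afterKind-from-shifts : ∀ κ δ (τ τ′ : Stats) → let open Stats in
    exc τ′ + 𝟙 (κ == excedance) ≡ exc τ + 1 → aexc τ′ + 𝟙 (κ == anti-excedance) ≡ aexc τ + 1 →
    single τ′ + 𝟙 (κ == singleton) ≡ single τ → fix τ′ + 𝟙 (κ == fixed-point) ≡ fix τ →
    neg τ′ ≡ neg τ + 𝟙 δ → cyc τ′ ≡ cyc τ → τ′ ≡ afterKind κ δ τ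
  afterKind-from-shifts excedance      δ _ _ e a s f refl refl rewrite kept e      | gained a | unchanged s | unchanged f = refl
  afterKind-from-shifts anti-excedance δ _ _ e a s f refl refl rewrite gained e    | kept a   | unchanged s | unchanged f = refl
  afterKind-from-shifts fixed-point    δ _ _ e a s f refl refl rewrite gained e    | gained a | unchanged s | lost f      = refl
  afterKind-from-shifts singleton      δ _ _ e a s f refl refl rewrite gained e    | gained a | lost s      | unchanged f = refl

  record InsertionLaw (stat : ∀ {m} → SPerm m → Stats) {n} (σ : SPerm n) : Set where
    field
      kind           : Fin n → Kind
      stat-new-cycle : ∀ δ → stat (insert σ (nothing , δ)) ≡ newCycle δ (stat σ)
      stat-after     : ∀ k δ → stat (insert σ (just k , δ)) ≡ afterKind (kind k) δ (stat σ)
      count-kind     : ∀ κ → count n (λ k → kind k == κ) ≡ multiplicity κ (stat σ)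

open Kinds

module InsertionLaws where

  open import Data.Bool using (Bool; true; false; not; _∧_)
  open import Data.Bool.Properties using (not-involutive)
  open import Data.Nat using (ℕ; _+_; _<ᵇ_; _<?_)
  open import Data.Nat.Properties using (<-irrefl; <-asym)
  open import Data.Fin using (Fin; toℕ; _≟_)
  open import Data.Fin.Properties using (toℕ<n; toℕ-injective)
  open import Data.Integer using () renaming (_<?_ to _<ℤ?_)
  open import Data.Vec using (lookup)
  open import Data.Maybe using (just; nothing)
  open import Data.Product using (_×_; _,_; proj₁; proj₂)
  open import Function using (_∘_)
  open import Relation.Binary.PropositionalEquality
  open import Relation.Nullary using (yes; no; does)
  open import Relation.Nullary.Decidable using (dec-true; dec-false)

  private variable
    n : ℕ

  stats-cong : ∀ {e a s f g c e′ a′ s′ f′ g′ c′} → e ≡ e′ → a ≡ a′ → s ≡ s′ → f ≡ f′ → g ≡ g′ → c ≡ c′ →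
               stats e a s f g c ≡ stats e′ a′ s′ f′ g′ c′
  stats-cong refl refl refl refl refl refl = refl

  below-top : ∀ {n} (j : Fin n) → (toℕ j <ᵇ n) ≡ true
  below-top {n} j = dec-true (toℕ j <? n) (toℕ<n j)

  top-above : ∀ {n} (j : Fin n) → (n <ᵇ toℕ j) ≡ false
  top-above {n} j = dec-false (n <? toℕ j) (<-asym (toℕ<n j))

  irreflexive : ∀ a → (a <ᵇ a) ≡ false
  irreflexive a = dec-false (a <? a) (<-irrefl refl)

  shift : ∀ {x y b c} → b ≡ c → x + 𝟙 c ≡ y → x + 𝟙 b ≡ y
  shift refl e = e

  module _ (σ : SPerm n) (inj : SignedInjective σ) where

    private
      fixed negative : Fin n → Bool
      fixed k    = does (∣ σ ∣ k ≟ k)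
      negative k = proj₁ (lookup σ k)

    private
      module ExcB = Comparisons (λ a b → does (a <ℤ? b)) (λ δ → δ) extreme-< <-extreme <-irreflexive σ inj
      module AexcB = Comparisons (λ a b → does (b <ℤ? a)) not <-extreme
                                 (λ δ u → trans (extreme-< δ u) (sym (not-involutive δ))) <-irreflexive σ inj
      module Single = SignedFixedPoints (λ b → b) σ inj
      module Fix = SignedFixedPoints not σ inj
      module ExcA = PositionComparisons _<ᵇ_ true below-top top-above irreflexive σ
      module AexcA = PositionComparisons (λ a b → b <ᵇ a) false top-above below-top irreflexive σ
    open Negatives σ inj

    statsB-insertionLaw : InsertionLaw statsB σ
    statsB-insertionLaw = record
      { kind           = kind
      ; stat-new-cycle = λ δ → stats-cong (ExcB.comparisons-new-cycle δ) (AexcB.comparisons-new-cycle δ)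
                           (Single.signedFixedPoints-new-cycle δ) (Fix.signedFixedPoints-new-cycle δ)
                           (negatives-new-cycle δ) (cycles-new-cycle σ inj δ)
      ; stat-after     = λ k δ → afterKind-from-shifts (kind k) δ (statsB σ) (statsB (insert σ (just k , δ)))
                           (shift (is-exc k) (ExcB.comparisons-after k δ))
                           (shift (is-aexc k) (AexcB.comparisons-after k δ))
                           (shift (is-single k) (Single.signedFixedPoints-after k δ))
                           (shift (is-fix k) (Fix.signedFixedPoints-after k δ))
                           (negatives-after k δ) (cycles-after σ inj k δ)
      ; count-kind     = λ { excedance → count-cong n is-exc ; anti-excedance → count-cong n is-aexc
                           ; fixed-point → count-cong n is-fix ; singleton → count-cong n is-single }
      }
      where
      ascent descent : Fin n → Bool
      ascent k  = does (value σ k <ℤ? next σ k)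
      descent k = does (next σ k <ℤ? value σ k)
      kind : Fin n → Kind
      kind k = classify (fixed k) (negative k) (ascent k)
      indicators : ∀ k → (kind k == excedance ≡ ascent k) × (kind k == anti-excedance ≡ descent k) ×
                         (kind k == fixed-point ≡ not (negative k) ∧ fixed k) × (kind k == singleton ≡ negative k ∧ fixed k)
      indicators k with ∣ σ ∣ k ≟ k
      ... | yes k↦k = classify-== true (negative k) (ascent k) (descent k)
                        (λ _ → trans (cong (λ w → does (value σ k <ℤ? w)) next≡value) (<-irreflexive (value σ k)) ,
                               trans (cong (λ w → does (w <ℤ? value σ k)) next≡value) (<-irreflexive (value σ k)))
                        (λ ())
        where
        next≡value : next σ k ≡ value σ k
        next≡value = cong (sval ∘ lookup σ) k↦k
      ... | no k↦̸k = classify-== false (negative k) (ascent k) (descent k) (λ ())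
                        (λ _ → <-flip (k↦̸k ∘ sym ∘ inj ∘ sval-injective (lookup σ k) (lookup σ (∣ σ ∣ k))))
      is-exc    : ∀ k → kind k == excedance ≡ ascent k
      is-aexc   : ∀ k → kind k == anti-excedance ≡ descent k
      is-fix    : ∀ k → kind k == fixed-point ≡ not (negative k) ∧ fixed k
      is-single : ∀ k → kind k == singleton ≡ negative k ∧ fixed k
      is-exc    = proj₁ ∘ indicators
      is-aexc   = proj₁ ∘ proj₂ ∘ indicators
      is-fix    = proj₁ ∘ proj₂ ∘ proj₂ ∘ indicators
      is-single = proj₂ ∘ proj₂ ∘ proj₂ ∘ indicators

    statsA-insertionLaw : InsertionLaw statsA σ
    statsA-insertionLaw = record
      { kind           = kind
      ; stat-new-cycle = λ δ → stats-cong
                           (trans (excA-absPerm (insert σ (nothing , δ)))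
                             (trans (ExcA.positionComparisons-new-cycle δ) (sym (excA-absPerm σ))))
                           (trans (aexcA-absPerm (insert σ (nothing , δ)))
                             (trans (AexcA.positionComparisons-new-cycle δ) (sym (aexcA-absPerm σ))))
                           (Single.signedFixedPoints-new-cycle δ) (Fix.signedFixedPoints-new-cycle δ)
                           (negatives-new-cycle δ) (cycles-new-cycle σ inj δ)
      ; stat-after     = λ k δ → afterKind-from-shifts (kind k) δ (statsA σ) (statsA (insert σ (just k , δ)))
                           (shift (is-exc k) (trans (cong (_+ 𝟙 (ascent (∣ σ ∣ k))) (excA-absPerm (insert σ (just k , δ))))
                             (trans (ExcA.positionComparisons-after k δ) (cong (_+ 1) (sym (excA-absPerm σ))))))
                           (shift (is-aexc k) (trans (cong (_+ 𝟙 (descent (∣ σ ∣ k))) (aexcA-absPerm (insert σ (just k , δ))))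
                             (trans (AexcA.positionComparisons-after k δ) (cong (_+ 1) (sym (aexcA-absPerm σ))))))
                           (shift (is-single k) (Single.signedFixedPoints-after k δ))
                           (shift (is-fix k) (Fix.signedFixedPoints-after k δ))
                           (negatives-after k δ) (cycles-after σ inj k δ)
      ; count-kind     = λ
          { excedance      → trans (count-cong n is-exc) (trans (count-reindex n inj ascent) (sym (excA-absPerm σ)))
          ; anti-excedance → trans (count-cong n is-aexc) (trans (count-reindex n inj descent) (sym (aexcA-absPerm σ)))
          ; fixed-point    → count-cong n is-fix
          ; singleton      → count-cong n is-single }
      }
      where
      ascent descent : Fin n → Bool
      ascent m  = toℕ m <ᵇ toℕ (∣ σ ∣ m)
      descent m = toℕ (∣ σ ∣ m) <ᵇ toℕ m
      kind : Fin n → Kind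
      kind k = classify (fixed k) (negative k) (ascent (∣ σ ∣ k))
      indicators : ∀ k → (kind k == excedance ≡ ascent (∣ σ ∣ k)) × (kind k == anti-excedance ≡ descent (∣ σ ∣ k)) ×
                         (kind k == fixed-point ≡ not (negative k) ∧ fixed k) × (kind k == singleton ≡ negative k ∧ fixed k)
      indicators k with ∣ σ ∣ k ≟ k
      ... | yes k↦k = classify-== true (negative k) (ascent (∣ σ ∣ k)) (descent (∣ σ ∣ k))
                        (λ _ → trans (cong (λ j → toℕ (∣ σ ∣ k) <ᵇ toℕ j) i↦i) (irreflexive (toℕ (∣ σ ∣ k))) ,
                               trans (cong (λ j → toℕ j <ᵇ toℕ (∣ σ ∣ k)) i↦i) (irreflexive (toℕ (∣ σ ∣ k))))
                        (λ ())
        where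
        i↦i : ∣ σ ∣ (∣ σ ∣ k) ≡ ∣ σ ∣ k
        i↦i = cong ∣ σ ∣ k↦k
      ... | no k↦̸k = classify-== false (negative k) (ascent (∣ σ ∣ k)) (descent (∣ σ ∣ k)) (λ ())
                        (λ _ → <ᵇ-flip (k↦̸k ∘ inj ∘ sym ∘ toℕ-injective))
      is-exc    : ∀ k → kind k == excedance ≡ ascent (∣ σ ∣ k)
      is-aexc   : ∀ k → kind k == anti-excedance ≡ descent (∣ σ ∣ k)
      is-fix    : ∀ k → kind k == fixed-point ≡ not (negative k) ∧ fixed k
      is-single : ∀ k → kind k == singleton ≡ negative k ∧ fixed k
      is-exc    = proj₁ ∘ indicators
      is-aexc   = proj₁ ∘ proj₂ ∘ indicators
      is-fix    = proj₁ ∘ proj₂ ∘ proj₂ ∘ indicators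
      is-single = proj₂ ∘ proj₂ ∘ proj₂ ∘ indicators

open InsertionLaws

module Transfer {c ℓ : Level} (R : CommutativeRing c ℓ) where
  open import Data.Bool using (Bool)
  open import Data.Nat using (ℕ; zero; suc)
  import Data.Nat as ℕ
  open import Data.Fin using (Fin; #_)
  import Data.Fin as Fin
  open import Data.List using (List; []; _∷_; map; allFin)
  open import Data.List.Properties using (map-tabulate)
  open import Data.Maybe using (just; nothing)
  open import Data.Product using (_,_)
  open import Data.List.Membership.Propositional using (_∈_)
  open import Function using (_∘_)
  open import Relation.Binary.PropositionalEquality as ≡ using (_≡_)
  import Algebra.Solver.CommutativeMonoid as CommutativeMonoidSolver
  open import Data.Vec using ([]; _∷_)
  open CommutativeRing R
  open Eval R
  open Sums R
  open import Algebra.Definitions.RawMonoid +-rawMonoid using (_×_)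
  open import Algebra.Properties.Monoid.Mult +-monoid using (×-homo-+)
  open import Relation.Binary.Reasoning.Setoid setoid
  open CommutativeMonoidSolver +-commutativeMonoid using (prove; var; id; _⊕_)

  private
    var₀ : CommutativeMonoidSolver.Expr +-commutativeMonoid 1
    var₀ = var (# 0)

  Σ-allFin-suc : ∀ n (f : Fin (suc n) → Carrier) → Σ (allFin (suc n)) f ≈ f Fin.zero + Σ (allFin n) (f ∘ Fin.suc)
  Σ-allFin-suc n f = +-congˡ (trans (reflexive (≡.cong (λ l → Σ l f) (≡.sym (map-tabulate (λ i → i) Fin.suc))))
                                    (Σ-map (allFin n) Fin.suc f))

  Σ-indicator : ∀ n (P : Fin n → Bool) u → Σ (allFin n) (λ k → 𝟙 (P k) × u) ≈ count n P × u
  Σ-indicator zero    P u = refl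
  Σ-indicator (suc n) P u = begin
    Σ (allFin (suc n)) (λ k → 𝟙 (P k) × u)                      ≈⟨ Σ-allFin-suc n _ ⟩
    𝟙 (P Fin.zero) × u + Σ (allFin n) (λ k → 𝟙 (P (Fin.suc k)) × u) ≈⟨ +-congˡ (Σ-indicator n (P ∘ Fin.suc) u) ⟩
    𝟙 (P Fin.zero) × u + count n (P ∘ Fin.suc) × u               ≈⟨ ×-homo-+ u (𝟙 (P Fin.zero)) _ ⟨
    (𝟙 (P Fin.zero) ℕ.+ count n (P ∘ Fin.suc)) × u               ≡⟨ ≡.cong (_× u) (count-suc n P) ⟨
    count (suc n) P × u                                          ∎

  kinds : List Kind
  kinds = excedance ∷ anti-excedance ∷ fixed-point ∷ singleton ∷ []

  -- after unfolding Σ, 1 × u = u + 0# and 0 × u = 0# this is an identity of commutative monoids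
  kind-expansion : ∀ κ₀ (h : Kind → Carrier) → h κ₀ ≈ Σ kinds (λ κ → 𝟙 (κ₀ == κ) × h κ)
  kind-expansion excedance      h = prove 1 var₀ ((var₀ ⊕ id) ⊕ (id ⊕ (id ⊕ (id ⊕ id)))) (h excedance ∷ [])
  kind-expansion anti-excedance h = prove 1 var₀ (id ⊕ ((var₀ ⊕ id) ⊕ (id ⊕ (id ⊕ id)))) (h anti-excedance ∷ [])
  kind-expansion fixed-point    h = prove 1 var₀ (id ⊕ (id ⊕ ((var₀ ⊕ id) ⊕ (id ⊕ id)))) (h fixed-point ∷ [])
  kind-expansion singleton      h = prove 1 var₀ (id ⊕ (id ⊕ (id ⊕ ((var₀ ⊕ id) ⊕ id)))) (h singleton ∷ [])

  Σ-by-kind : ∀ n (kind : Fin n → Kind) (h : Kind → Carrier) →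
              Σ (allFin n) (h ∘ kind) ≈ Σ kinds (λ κ → count n (λ k → kind k == κ) × h κ)
  Σ-by-kind n kind h = begin
    Σ (allFin n) (h ∘ kind)                                     ≈⟨ Σ-cong (allFin n) (λ k → kind-expansion (kind k) h) ⟩
    Σ (allFin n) (λ k → Σ kinds (λ κ → 𝟙 (kind k == κ) × h κ))  ≈⟨ Σ-swap (allFin n) kinds (λ k κ → 𝟙 (kind k == κ) × h κ) ⟩
    Σ kinds (λ κ → Σ (allFin n) (λ k → 𝟙 (kind k == κ) × h κ))  ≈⟨ Σ-cong kinds (λ κ → Σ-indicator n (λ k → kind k == κ) (h κ)) ⟩
    Σ kinds (λ κ → count n (λ k → kind k == κ) × h κ)            ∎

  transfer : (Stats → Carrier) → Stats → Carrier
  transfer w τ = Σ signs (λ δ → w (newCycle δ τ)) +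
                 Σ kinds (λ κ → multiplicity κ τ × Σ signs (λ δ → w (afterKind κ δ τ)))

  Σ-insert : ∀ {stat : ∀ {m} → SPerm m → Stats} {n} {σ : SPerm n} → InsertionLaw stat σ → ∀ w →
             Σ (choices n) (λ c → w (stat (insert σ c))) ≈ transfer w (stat σ)
  Σ-insert {stat} {n} {σ} law w = begin
    Σ (choices n) g
      ≈⟨ Σ-concatMap (nothing ∷ map just (allFin n)) (λ mk → map (mk ,_) signs) g ⟩
    Σ (map (nothing ,_) signs) g + Σ (map just (allFin n)) (λ mk → Σ (map (mk ,_) signs) g)
      ≈⟨ +-cong (Σ-map signs (nothing ,_) g)
                (trans (Σ-map (allFin n) just _) (Σ-cong (allFin n) (λ k → Σ-map signs (just k ,_) g))) ⟩
    Σ signs (λ δ → g (nothing , δ)) + Σ (allFin n) (λ k → Σ signs (λ δ → g (just k , δ)))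
      ≈⟨ +-cong (Σ-cong signs (λ δ → reflexive (≡.cong w (stat-new-cycle δ))))
                (Σ-cong (allFin n) (λ k → Σ-cong signs (λ δ → reflexive (≡.cong w (stat-after k δ))))) ⟩
    Σ signs (λ δ → w (newCycle δ τ)) + Σ (allFin n) (H ∘ kind)
      ≈⟨ +-congˡ (Σ-by-kind n kind H) ⟩
    Σ signs (λ δ → w (newCycle δ τ)) + Σ kinds (λ κ → count n (λ k → kind k == κ) × H κ)
      ≈⟨ +-congˡ (Σ-cong kinds (λ κ → reflexive (≡.cong (_× H κ) (count-kind κ)))) ⟩
    transfer w τ
      ∎
    where
    open InsertionLaw law
    τ : Stats
    τ = stat σ
    g : Choice n → Carrier
    g c = w (stat (insert σ c))
    H : Kind → Carrier
    H κ = Σ signs (λ δ → w (afterKind κ δ τ))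

  Σ-insertions : ∀ {stat : ∀ {m} → SPerm m → Stats} n → (∀ {σ} → σ ∈ SBn n → InsertionLaw stat σ) → ∀ w →
                 Σ (insertions n) (w ∘ stat) ≈ Σ (SBn n) (transfer w ∘ stat)
  Σ-insertions n law w = trans (Σ-concatMap (SBn n) (λ σ → map (insert σ) (choices n)) _)
    (Σ-cong-∈ (SBn n) (λ σ σ∈ → trans (Σ-map (choices n) (insert σ) _) (Σ-insert (law σ∈) w)))

  statsB-statsA-equidistributed : ∀ n (w : Stats → Carrier) → Σ (SBn n) (w ∘ statsB) ≈ Σ (SBn n) (w ∘ statsA)
  statsB-statsA-equidistributed zero    w = refl
  statsB-statsA-equidistributed (suc n) w = begin
    Σ (SBn (suc n)) (w ∘ statsB)     ≈⟨ Σ-↭ (w ∘ statsB) (SBn-suc-↭-insertions n) ⟩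
    Σ (insertions n) (w ∘ statsB)    ≈⟨ Σ-insertions n (λ σ∈ → statsB-insertionLaw _ (∈-SBn⁻ σ∈)) w ⟩
    Σ (SBn n) (transfer w ∘ statsB)  ≈⟨ statsB-statsA-equidistributed n (transfer w) ⟩
    Σ (SBn n) (transfer w ∘ statsA)  ≈⟨ Σ-insertions n (λ σ∈ → statsA-insertionLaw _ (∈-SBn⁻ σ∈)) w ⟨
    Σ (insertions n) (w ∘ statsA)    ≈⟨ Σ-↭ (w ∘ statsA) (SBn-suc-↭-insertions n) ⟨
    Σ (SBn (suc n)) (w ∘ statsA)     ∎

theorem24 : ∀ {c ℓ : Level} (R : CommutativeRing c ℓ) (n : ℕ) → 1 ≤ n →
    (x y s t p q : CommutativeRing.Carrier R) →
    CommutativeRing._≈_ R (Eval.B R n x y s t p q) (Eval.RHS R n x y s t p q)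
theorem24 R n _ x y s t p q =
  CommutativeRing.trans R (statsB-statsA-equidistributed n weight) (Σ-weight-statsA n)
  where
  open Weight R x y s t p q using (weight; Σ-weight-statsA)
  open Transfer R using (statsB-statsA-equidistributed)
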